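{- Let $F\in C(m,n)$ be a good rectangular preorder with exactly two equivalence classes $C_1<C_2$, where $C_1$ contains at least one horizontal collision $l_i$ and at least one vertical collision $m_j$. Write $\{i: l_i\in C_1\}=\bigcup_s I_s$ and $\{j: m_j\in C_1\}=\bigcup_t J_t$ as disjoint unions of maximal sets of consecutive integers, and set $a_s=|I_s|+1$, $b_t=|J_t|+1$. Then for every vertex $v$ with $v\le F$, $$\sum_{i\in\bigcup_s I_s}y_i+\sum_{j\in\bigcup_t J_t}x_j=\sum_s\binom{a_s}{2}+\sum_t\binom{b_t}{2}+\sum_{s,t}\binom{a_s}{2}\binom{b_t}{2},$$ and for every vertex $v$ incomparable with $F$ the left-hand side is strictly greater than the right-hand side (coordinates computed at $v$).
   Context: Fix positive integers $m,n$. $\mathsf{Coll}(m,n)$ is the set of formal symbols $m_1,\dots,m_{m-1}$ ($m_j$ = collision of vertical lines $M_j,M_{j+1}$) and $l_1,\dots,l_{n-1}$ ($l_i$ = collision of horizontal lines $L_i,L_{i+1}$). A preorder is a reflexive transitive relation $\le$; $x\equiv y$ means $x\le y$ and $y\le x$, $x<y$ means $x\le y$ but not $y\le x$, and $x,y$ are comparable if $x\le y$ or $y\le x$. Pairs $\{m_j,l_i\}$ are orthogonal; $\{m_j,m_{j'}\}$ and $\{l_i,l_{i'}\}$ are parallel. Given a preorder, an orthogonal link between parallel $m_i,m_j$ is an $l_s$ with $m_i\le l_s\le m_j$ or $m_j\le l_s\le m_i$; a gap between $m_i,m_j$ is an $m_s$ with $s$ between $i$ and $j$ inclusive and $m_i<m_s$,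 $m_j<m_s$; symmetrically for $l$'s. A preorder is good rectangular if (1) orthogonal collisions are always comparable and (2) parallel collisions are comparable iff there is an orthogonal link between them or no gap between them. $C(m,n)$ is the set of good rectangular preorders ordered by $P\le Q$ iff $x\le_P y$ implies $x\le_Q y$; a vertex is one in which $x\equiv y$ implies $x=y$. Coordinates of a vertex $v$ (comparisons in $v$): $y_i=W_1W_2T$ ($1\le i\le n-1$) with $W_1=i-p+1$ where $p$ is smallest such that $l_k<l_i$ for all $p\le k<i$; $W_2=q-i$ where $q\le n$ is largest such that $l_k<l_i$ for all $i<k<q$; $T=1+\#\{(a,b):1\le a<b\le m,\ m_k<l_i\ \forall\, a\le k<b\}$. Symmetrically $x_j=W_1W_2T$ ($1\le j\le m-1$) with $W_1=j-p+1$, $p$ smallest with $m_k<m_j$ for $p\le k<j$; $W_2=q-j$, $q\le m$ largest with $m_k<m_j$ for $j<k<q$; $T=1+\#\{(a,b):1\le a<b\le n,\ l_k<m_j\ \forall\, a\le k<b\}$. -}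

module Defs where

open import Data.Nat using (ℕ; zero; suc; _+_; _*_; _∸_; _≤_; _<_; _<?_; pred; _<ᵇ_)
open import Data.Nat.Combinatorics using (_C_)
open import Data.Fin using (Fin; toℕ; fromℕ<)
open import Data.Bool using (Bool; true; false; _∧_; _∨_; not; if_then_else_)
open import Data.Maybe using (Maybe; just; nothing)
open import Data.List using (List; []; _∷_; map; upTo; allFin; all)
open import Data.Nat.ListAction using (sum)
open import Data.Product using (Σ; _×_; _,_)
open import Data.Sum using (_⊎_)
open import Relation.Nullary using (¬_; yes; no)
open import Relation.Binary.PropositionalEquality using (_≡_)

-- Collisions for an m × n configuration (0-based Fin indices):
--   vc k  is  m_{k+1}  (k = 0 .. m-2),   hc k  is  l_{k+1}  (k = 0 .. n-2).
data Coll (m n : ℕ) : Set where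
  vc : Fin (pred m) → Coll m n
  hc : Fin (pred n) → Coll m n

BRel : ℕ → ℕ → Set
BRel m n = Coll m n → Coll m n → Bool

module _ {m n : ℕ} where

  _≤[_]_ : Coll m n → BRel m n → Coll m n → Set
  x ≤[ R ] y = R x y ≡ true

  ltB : BRel m n → Coll m n → Coll m n → Bool
  ltB R x y = R x y ∧ not (R y x)

  _<[_]_ : Coll m n → BRel m n → Coll m n → Set
  x <[ R ] y = ltB R x y ≡ true

  Comparable : BRel m n → Coll m n → Coll m n → Set
  Comparable R x y = x ≤[ R ] y ⊎ y ≤[ R ] x

  IsPreorder : BRel m n → Set
  IsPreorder R = (∀ x → x ≤[ R ] x)
               × (∀ x y z → x ≤[ R ] y → y ≤[ R ] z → x ≤[ R ] z)

  Between : {k : ℕ} → Fin k → Fin k → Fin k → Set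
  Between j j' s = (toℕ j ≤ toℕ s × toℕ s ≤ toℕ j') ⊎ (toℕ j' ≤ toℕ s × toℕ s ≤ toℕ j)

  OrthLinkV : BRel m n → Fin (pred m) → Fin (pred m) → Set
  OrthLinkV R j j' = Σ (Fin (pred n)) λ s →
      (vc j ≤[ R ] hc s × hc s ≤[ R ] vc j') ⊎ (vc j' ≤[ R ] hc s × hc s ≤[ R ] vc j)

  OrthLinkH : BRel m n → Fin (pred n) → Fin (pred n) → Set
  OrthLinkH R i i' = Σ (Fin (pred m)) λ s →
      (hc i ≤[ R ] vc s × vc s ≤[ R ] hc i') ⊎ (hc i' ≤[ R ] vc s × vc s ≤[ R ] hc i)

  GapV : BRel m n → Fin (pred m) → Fin (pred m) → Set
  GapV R j j' = Σ (Fin (pred m)) λ s →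
      Between j j' s × vc j <[ R ] vc s × vc j' <[ R ] vc s

  GapH : BRel m n → Fin (pred n) → Fin (pred n) → Set
  GapH R i i' = Σ (Fin (pred n)) λ s →
      Between i i' s × hc i <[ R ] hc s × hc i' <[ R ] hc s

  IsGoodRect : BRel m n → Set
  IsGoodRect R = IsPreorder R
    × (∀ j i → Comparable R (vc j) (hc i))
    × (∀ j j' → (Comparable R (vc j) (vc j') → OrthLinkV R j j' ⊎ ¬ GapV R j j')
              × (OrthLinkV R j j' ⊎ ¬ GapV R j j' → Comparable R (vc j) (vc j')))
    × (∀ i i' → (Comparable R (hc i) (hc i') → OrthLinkH R i i' ⊎ ¬ GapH R i i')
              × (OrthLinkH R i i' ⊎ ¬ GapH R i i' → Comparable R (hc i) (hc i')))

  _⊑_ : BRel m n → BRel m n → Set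
  P ⊑ Q = ∀ x y → x ≤[ P ] y → x ≤[ Q ] y

  IsVertex : BRel m n → Set
  IsVertex R = IsGoodRect R × (∀ x y → x ≤[ R ] y → y ≤[ R ] x → x ≡ y)

  vAt : ℕ → Maybe (Coll m n)
  vAt k with k <? pred m
  ... | yes p = just (vc (fromℕ< p))
  ... | no _  = nothing

  hAt : ℕ → Maybe (Coll m n)
  hAt k with k <? pred n
  ... | yes p = just (hc (fromℕ< p))
  ... | no _  = nothing

  ltAt : BRel m n → Maybe (Coll m n) → Coll m n → Bool
  ltAt R (just x) y = ltB R x y
  ltAt R nothing  y = false

leftRun : (ℕ → Bool) → ℕ → ℕ
leftRun f zero    = zero
leftRun f (suc k) = if f k then suc (leftRun f k) else zero

rightRun : (ℕ → Bool) → ℕ → ℕ → ℕ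
rightRun f s zero       = zero
rightRun f s (suc fuel) = if f s then suc (rightRun f (suc s) fuel) else zero

-- #{(a,b) : 0 ≤ a < b ≤ N-1, f k for all a ≤ k < b}
-- (0-based version of  #{(a,b) : 1 ≤ a < b ≤ N, ∀ a ≤ k < b, ...})
pairCount : (ℕ → Bool) → ℕ → ℕ
pairCount f N = sum (map (λ a → sum (map (λ b →
    if (a <ᵇ b) ∧ all f (map (a +_) (upTo (b ∸ a))) then 1 else 0) (upTo N))) (upTo N))

module _ {m n : ℕ} where

  -- y_i = W₁ W₂ T  for l_{i+1} (0-based i)
  yCoord : BRel m n → Fin (pred n) → ℕ
  yCoord R i = W₁ * W₂ * T
    where
      f : ℕ → Bool
      f k = ltAt R (hAt k) (hc i)
      W₁ = suc (leftRun f (toℕ i))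
      W₂ = suc (rightRun f (suc (toℕ i)) (pred n ∸ suc (toℕ i)))
      T  = suc (pairCount (λ k → ltAt R (vAt k) (hc i)) m)

  -- x_j = W₁ W₂ T  for m_{j+1} (0-based j)
  xCoord : BRel m n → Fin (pred m) → ℕ
  xCoord R j = W₁ * W₂ * T
    where
      f : ℕ → Bool
      f k = ltAt R (vAt k) (vc j)
      W₁ = suc (leftRun f (toℕ j))
      W₂ = suc (rightRun f (suc (toℕ j)) (pred m ∸ suc (toℕ j)))
      T  = suc (pairCount (λ k → ltAt R (hAt k) (vc j)) n)

runsAux : ℕ → List Bool → List ℕ
runsAux zero    []           = []
runsAux (suc k) []           = suc k ∷ []
runsAux k       (true ∷ xs)  = runsAux (suc k) xs
runsAux zero    (false ∷ xs) = runsAux zero xs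
runsAux (suc k) (false ∷ xs) = suc k ∷ runsAux zero xs

runs : List Bool → List ℕ
runs = runsAux zero

module _ {m n : ℕ} where

  hBlocks : (Coll m n → Bool) → List ℕ
  hBlocks c = runs (map (λ i → c (hc i)) (allFin (pred n)))

  vBlocks : (Coll m n → Bool) → List ℕ
  vBlocks c = runs (map (λ j → c (vc j)) (allFin (pred m)))

  lhsSum : (Coll m n → Bool) → BRel m n → ℕ
  lhsSum c v = sum (map (λ i → if c (hc i) then yCoord v i else 0) (allFin (pred n)))
             + sum (map (λ j → if c (vc j) then xCoord v j else 0) (allFin (pred m)))

  rhsSum : (Coll m n → Bool) → ℕ
  rhsSum c = sum (map (λ k → suc k C 2) as) + sum (map (λ k → suc k C 2) bs)
           + sum (map (λ a → sum (map (λ b → (suc a C 2) * (suc b C 2)) bs)) as)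
    where
      as = hBlocks c
      bs = vBlocks c

  -- F has exactly two equivalence classes C₁ < C₂, where C₁ = {x : c x ≡ true},
  -- C₂ = {x : c x ≡ false}, both nonempty:  x ≤_F y  iff  x ∈ C₁ or y ∈ C₂.
  TwoClasses : BRel m n → (Coll m n → Bool) → Set
  TwoClasses F c = (∀ x y → (x ≤[ F ] y → (c x ≡ true ⊎ c y ≡ false))
                          × ((c x ≡ true ⊎ c y ≡ false) → x ≤[ F ] y))
                 × Σ (Coll m n) (λ x → c x ≡ true)
                 × Σ (Coll m n) (λ y → c y ≡ false)

module Submission where

open import Defs
open import Data.Bool using (Bool; true; false; _∧_; if_then_else_)
open import Data.Bool.Properties using (∧-identityʳ; ∧-zeroʳ; ∧-conicalˡ; ∧-conicalʳ; T-≡; ⇔→≡)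
open import Data.Empty using (⊥; ⊥-elim)
open import Data.Fin using (Fin; toℕ; fromℕ<) renaming (zero to fzero; suc to fsuc)
open import Data.Fin.Properties using (toℕ<n; fromℕ<-toℕ; toℕ-fromℕ<)
open import Data.Bool.ListAction using (all)
open import Data.List using (List; []; _∷_; map; applyUpTo; upTo; allFin; tabulate)
open import Data.List.Properties using (map-cong; map-upTo; map-tabulate)
open import Data.Maybe using (Maybe; just; nothing)
open import Data.Nat
open import Data.Nat.Combinatorics using (_C_; nC1≡n; nCk+nC[k+1]≡[n+1]C[k+1])
open import Data.Nat.ListAction using (sum)
open import Data.Nat.Properties
open import Algebra.Properties.CommutativeSemigroup +-commutativeSemigroup using (interchange)
open import Data.Nat.Tactic.RingSolver using (solve-∀)
open import Data.Product using (Σ; _×_; _,_; proj₁; proj₂)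
open import Data.Sum using (_⊎_; inj₁; inj₂; swap)
open import Function using (_∘_; id; Equivalence; mk⇔)
open import Relation.Binary using (tri<; tri≈; tri>)
open import Relation.Nullary using (¬_; yes; no)
open import Relation.Binary.PropositionalEquality

-- Read W₁ W₂ at l_i as the number of intervals of consecutive horizontal
-- positions whose strict maximum in v is l_i, and T − 1 as the number of
-- intervals of vertical positions lying entirely below l_i (symmetrically for
-- x_j). The left-hand side then counts the horizontal and vertical intervals
-- whose maximum is in C₁, plus the pairs (horizontal interval, vertical
-- interval) in which one interval lies below the maximum of the other and this
-- larger maximum is in C₁; orthogonal maxima are comparable, so only one of the
-- two orders can occur. The right-hand side counts the intervals contained in
-- C₁ and the pairs of them. Each right-hand term is dominated by the matching
-- left-hand term, with equality everywhere when C₁ is a down-set of v, i.e.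
-- when v ≤ F. Otherwise some x < y in v has x ∈ C₂ and y ∈ C₁ and one term
-- becomes strict: the pair of singletons {x}, {y} for orthogonal x, y; for
-- parallel x, y an orthogonal link reduces to that case, and without one there
-- is no gap, so the interval spanned by x and y has maximum y ∈ C₁ but is not
-- contained in C₁.

𝟙 : Bool → ℕ
𝟙 b = if b then 1 else 0

𝟙-∧ : ∀ a b → 𝟙 a * 𝟙 b ≡ 𝟙 (a ∧ b)
𝟙-∧ false b     = refl
𝟙-∧ true  false = refl
𝟙-∧ true  true  = refl

𝟙-*-≤ˡ : ∀ a b → 𝟙 a * 𝟙 b ≤ 𝟙 a
𝟙-*-≤ˡ false b     = z≤n
𝟙-*-≤ˡ true  false = z≤n
𝟙-*-≤ˡ true  true  = ≤-refl

𝟙-*-≤ʳ : ∀ a b → 𝟙 a * 𝟙 b ≤ 𝟙 b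
𝟙-*-≤ʳ false b     = z≤n
𝟙-*-≤ʳ true  false = z≤n
𝟙-*-≤ʳ true  true  = ≤-refl

𝟙-mono : ∀ {a b} → (a ≡ true → b ≡ true) → 𝟙 a ≤ 𝟙 b
𝟙-mono {false} h = z≤n
𝟙-mono {true}  h rewrite h refl = ≤-refl

if-𝟙 : ∀ b c → (if b then 𝟙 c else 0) ≡ 𝟙 (b ∧ c)
if-𝟙 false c = refl
if-𝟙 true  c = refl

if-* : ∀ b y → (if b then y else 0) ≡ 𝟙 b * y
if-* false y = refl
if-* true  y = sym (+-identityʳ y)

true≢false : true ≢ false
true≢false ()

≡-by-⇔ : ∀ {a b} → (a ≡ true → b ≡ true) → (b ≡ true → a ≡ true) → a ≡ b
≡-by-⇔ f g = ⇔→≡ (mk⇔ f g)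

∧-intro : ∀ {a b} → a ≡ true → b ≡ true → a ∧ b ≡ true
∧-intro refl refl = refl

<ᵇ⇒<′ : ∀ {m n} → (m <ᵇ n) ≡ true → m < n
<ᵇ⇒<′ {m} {n} e = <ᵇ⇒< m n (Equivalence.from T-≡ e)

<⇒<ᵇ′ : ∀ {m n} → m < n → (m <ᵇ n) ≡ true
<⇒<ᵇ′ p = Equivalence.to T-≡ (<⇒<ᵇ p)

≤ᵇ⇒≤′ : ∀ {m n} → (m ≤ᵇ n) ≡ true → m ≤ n
≤ᵇ⇒≤′ {m} {n} e = ≤ᵇ⇒≤ m n (Equivalence.from T-≡ e)

≤⇒≤ᵇ′ : ∀ {m n} → m ≤ n → (m ≤ᵇ n) ≡ true
≤⇒≤ᵇ′ p = Equivalence.to T-≡ (≤⇒≤ᵇ p)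

≮⇒<ᵇ≡false : ∀ {m n} → ¬ m < n → (m <ᵇ n) ≡ false
≮⇒<ᵇ≡false {m} {n} m≮n with m <ᵇ n in eq
... | false = refl
... | true  = ⊥-elim (m≮n (<ᵇ⇒<′ eq))

<ᵇ-suc : ∀ p i → (p <ᵇ suc i) ≡ (p ≤ᵇ i)
<ᵇ-suc zero    i = refl
<ᵇ-suc (suc p) i = refl

-- Finite sums

∑ : ℕ → (ℕ → ℕ) → ℕ
∑ n f = sum (applyUpTo f n)

∑-cong : ∀ n {f g : ℕ → ℕ} → (∀ k → k < n → f k ≡ g k) → ∑ n f ≡ ∑ n g
∑-cong zero    h = refl
∑-cong (suc n) h = cong₂ _+_ (h 0 z<s) (∑-cong n (λ k k<n → h (suc k) (s<s k<n)))

∑-zero : ∀ n {f : ℕ → ℕ} → (∀ k → k < n → f k ≡ 0) → ∑ n f ≡ 0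
∑-zero zero    h = refl
∑-zero (suc n) h = cong₂ _+_ (h 0 z<s) (∑-zero n (λ k k<n → h (suc k) (s<s k<n)))

∑-distrib-+ : ∀ n (f g : ℕ → ℕ) → ∑ n (λ k → f k + g k) ≡ ∑ n f + ∑ n g
∑-distrib-+ zero    f g = refl
∑-distrib-+ (suc n) f g =
  trans (cong (f 0 + g 0 +_) (∑-distrib-+ n (f ∘ suc) (g ∘ suc)))
        (interchange (f 0) (g 0) (∑ n (f ∘ suc)) (∑ n (g ∘ suc)))

∑-*ˡ : ∀ n a (f : ℕ → ℕ) → ∑ n (λ k → a * f k) ≡ a * ∑ n f
∑-*ˡ zero    a f = sym (*-zeroʳ a)
∑-*ˡ (suc n) a f = trans (cong (a * f 0 +_) (∑-*ˡ n a (f ∘ suc))) (sym (*-distribˡ-+ a (f 0) _))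

∑-*ʳ : ∀ n a (f : ℕ → ℕ) → ∑ n (λ k → f k * a) ≡ ∑ n f * a
∑-*ʳ n a f = trans (∑-cong n (λ k _ → *-comm (f k) a)) (trans (∑-*ˡ n a f) (*-comm a _))

∑-swap : ∀ n m (f : ℕ → ℕ → ℕ) → ∑ n (λ i → ∑ m (f i)) ≡ ∑ m (λ j → ∑ n (λ i → f i j))
∑-swap zero    m f = sym (∑-zero m (λ _ _ → refl))
∑-swap (suc n) m f =
  trans (cong (∑ m (f 0) +_) (∑-swap n m (f ∘ suc))) (sym (∑-distrib-+ m (f 0) _))

∑-split : ∀ a b (f : ℕ → ℕ) → ∑ (a + b) f ≡ ∑ a f + ∑ b (λ d → f (a + d))
∑-split zero    b f = refl
∑-split (suc a) b f = trans (cong (f 0 +_) (∑-split a b (f ∘ suc))) (sym (+-assoc (f 0) _ _))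

∑-last : ∀ n (f : ℕ → ℕ) → ∑ (suc n) f ≡ ∑ n f + f n
∑-last n f = begin
  ∑ (suc n) f                                ≡⟨ cong (λ k → ∑ k f) (+-comm 1 n) ⟩
  ∑ (n + 1) f                                ≡⟨ ∑-split n 1 f ⟩
  ∑ n f + (f (n + 0) + 0)                    ≡⟨ cong (λ k → ∑ n f + (f k + 0)) (+-identityʳ n) ⟩
  ∑ n f + (f n + 0)                          ≡⟨ cong (∑ n f +_) (+-identityʳ (f n)) ⟩
  ∑ n f + f n                                ∎
  where open ≡-Reasoning

∑-mono-≤ : ∀ n {f g : ℕ → ℕ} → (∀ k → k < n → f k ≤ g k) → ∑ n f ≤ ∑ n g
∑-mono-≤ zero    h = z≤n
∑-mono-≤ (suc n) h = +-mono-≤ (h 0 z<s) (∑-mono-≤ n (λ k k<n → h (suc k) (s<s k<n)))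

∑-mono-< : ∀ n {f g : ℕ → ℕ} → (∀ k → k < n → f k ≤ g k) →
           ∀ i → i < n → f i < g i → ∑ n f < ∑ n g
∑-mono-< (suc n) h zero    _         lt = +-mono-<-≤ lt (∑-mono-≤ n (λ k k<n → h (suc k) (s<s k<n)))
∑-mono-< (suc n) h (suc i) (s<s i<n) lt =
  +-mono-≤-< (h 0 z<s) (∑-mono-< n (λ k k<n → h (suc k) (s<s k<n)) i i<n lt)

∑-single : ∀ n {f : ℕ → ℕ} i → i < n → (∀ k → k < n → k ≢ i → f k ≡ 0) → ∑ n f ≡ f i
∑-single (suc n) zero z<s h =
  trans (cong (_ +_) (∑-zero n (λ k k<n → h (suc k) (s<s k<n) (λ ())))) (+-identityʳ _)
∑-single (suc n) (suc i) (s<s i<n) h =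
  cong₂ _+_ (h 0 z<s (λ ())) (∑-single n i i<n (λ k k<n k≢i → h (suc k) (s<s k<n) (k≢i ∘ suc-injective)))

∑-restrict : ∀ k r (f : ℕ → ℕ) → ∑ k f ≡ ∑ (k + r) (λ p → if p <ᵇ k then f p else 0)
∑-restrict k r f = begin
  ∑ k f                             ≡⟨ ∑-cong k (λ p p<k → sym (inside p p<k)) ⟩
  ∑ k g                             ≡⟨ sym (+-identityʳ _) ⟩
  ∑ k g + 0                         ≡⟨ cong (∑ k g +_) (sym (∑-zero r (λ d _ → outside d))) ⟩
  ∑ k g + ∑ r (λ d → g (k + d))     ≡⟨ sym (∑-split k r g) ⟩
  ∑ (k + r) g                       ∎
  where
    open ≡-Reasoning
    g : ℕ → ℕ
    g p = if p <ᵇ k then f p else 0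
    inside : ∀ p → p < k → g p ≡ f p
    inside p p<k with p <ᵇ k | <⇒<ᵇ p<k
    ... | true | _ = refl
    outside : ∀ d → g (k + d) ≡ 0
    outside d with (k + d) <ᵇ k in eq
    ... | false = refl
    ... | true  = ⊥-elim (m+n≮m k d (<ᵇ⇒<′ eq))

∑-shift : ∀ s r (f : ℕ → ℕ) → ∑ r (λ d → f (s + d)) ≡ ∑ (s + r) (λ q → if s ≤ᵇ q then f q else 0)
∑-shift s r f = begin
  ∑ r (λ d → f (s + d))             ≡⟨ ∑-cong r (λ d _ → sym (inside d)) ⟩
  ∑ r (λ d → g (s + d))             ≡⟨ cong (_+ ∑ r (λ d → g (s + d))) (sym (∑-zero s outside)) ⟩
  ∑ s g + ∑ r (λ d → g (s + d))     ≡⟨ sym (∑-split s r g) ⟩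
  ∑ (s + r) g                       ∎
  where
    open ≡-Reasoning
    g : ℕ → ℕ
    g q = if s ≤ᵇ q then f q else 0
    inside : ∀ d → g (s + d) ≡ f (s + d)
    inside d with s ≤ᵇ (s + d) | ≤⇒≤ᵇ (m≤m+n s d)
    ... | true | _ = refl
    outside : ∀ q → q < s → g q ≡ 0
    outside q q<s with s ≤ᵇ q in eq
    ... | false = refl
    ... | true  = ⊥-elim (<⇒≱ q<s (≤ᵇ⇒≤′ eq))

∑∑ : ℕ → ℕ → (ℕ → ℕ → ℕ) → ℕ
∑∑ n m f = ∑ n (λ a → ∑ m (f a))

∑∑-cong : ∀ n m {f g : ℕ → ℕ → ℕ} → (∀ a b → a < n → b < m → f a b ≡ g a b) → ∑∑ n m f ≡ ∑∑ n m g
∑∑-cong n m h = ∑-cong n (λ a a< → ∑-cong m (λ b b< → h a b a< b<))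

∑∑-distrib-+ : ∀ n m (f g : ℕ → ℕ → ℕ) → ∑∑ n m (λ a b → f a b + g a b) ≡ ∑∑ n m f + ∑∑ n m g
∑∑-distrib-+ n m f g = trans (∑-cong n (λ a _ → ∑-distrib-+ m (f a) (g a))) (∑-distrib-+ n _ _)

∑∑-*ˡ : ∀ n m x (f : ℕ → ℕ → ℕ) → x * ∑∑ n m f ≡ ∑∑ n m (λ a b → x * f a b)
∑∑-*ˡ n m x f = trans (sym (∑-*ˡ n x _)) (∑-cong n (λ a _ → sym (∑-*ˡ m x (f a))))

∑∑-*ʳ : ∀ n m x (f : ℕ → ℕ → ℕ) → ∑∑ n m f * x ≡ ∑∑ n m (λ a b → f a b * x)
∑∑-*ʳ n m x f = trans (sym (∑-*ʳ n x _)) (∑-cong n (λ a _ → sym (∑-*ʳ m x (f a))))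

∑-∑∑-swap : ∀ k n m (f : ℕ → ℕ → ℕ → ℕ) → ∑ k (λ i → ∑∑ n m (f i)) ≡ ∑∑ n m (λ a b → ∑ k (λ i → f i a b))
∑-∑∑-swap k n m f = trans (∑-swap k n _) (∑-cong n (λ a _ → ∑-swap k m (λ i b → f i a b)))

∑∑-swap : ∀ n m k l (f : ℕ → ℕ → ℕ → ℕ → ℕ) →
          ∑∑ n m (λ a b → ∑∑ k l (f a b)) ≡ ∑∑ k l (λ p q → ∑∑ n m (λ a b → f a b p q))
∑∑-swap n m k l f =
  trans (∑-cong n (λ a _ → ∑-∑∑-swap m k l (f a))) (∑-∑∑-swap n k l (λ a p q → ∑ m (λ b → f a b p q)))

∑∑-mono-≤ : ∀ n m {f g : ℕ → ℕ → ℕ} → (∀ a b → a < n → b < m → f a b ≤ g a b) → ∑∑ n m f ≤ ∑∑ n m g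
∑∑-mono-≤ n m h = ∑-mono-≤ n (λ a a< → ∑-mono-≤ m (λ b b< → h a b a< b<))

∑∑-mono-< : ∀ n m {f g : ℕ → ℕ → ℕ} → (∀ a b → a < n → b < m → f a b ≤ g a b) →
            ∀ a b → a < n → b < m → f a b < g a b → ∑∑ n m f < ∑∑ n m g
∑∑-mono-< n m h a b a< b< lt =
  ∑-mono-< n (λ a a< → ∑-mono-≤ m (λ b → h a b a<)) a a< (∑-mono-< m (λ b → h a b a<) b b< lt)

-- Runs of a Boolean predicate and interval counts

allIn : (ℕ → Bool) → ℕ → ℕ → Bool
allIn f a b = all f (map (a +_) (upTo (b ∸ a)))

AllIn : (ℕ → Bool) → ℕ → ℕ → Set
AllIn f a b = ∀ k → a ≤ k → k < b → f k ≡ true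

module _ (f : ℕ → Bool) where

  private
    all-applyUpTo⁻ : ∀ g d → all f (applyUpTo g d) ≡ true → ∀ k → k < d → f (g k) ≡ true
    all-applyUpTo⁻ g (suc d) e zero    _         = ∧-conicalˡ _ _ e
    all-applyUpTo⁻ g (suc d) e (suc k) (s<s k<d) = all-applyUpTo⁻ (g ∘ suc) d (∧-conicalʳ _ _ e) k k<d

    all-applyUpTo⁺ : ∀ g d → (∀ k → k < d → f (g k) ≡ true) → all f (applyUpTo g d) ≡ true
    all-applyUpTo⁺ g zero    h = refl
    all-applyUpTo⁺ g (suc d) h = ∧-intro (h 0 z<s) (all-applyUpTo⁺ (g ∘ suc) d (λ k k<d → h (suc k) (s<s k<d)))

    allIn-applyUpTo : ∀ a b → allIn f a b ≡ all f (applyUpTo (a +_) (b ∸ a))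
    allIn-applyUpTo a b = cong (all f) (map-upTo (a +_) (b ∸ a))

    +-<-∸ : ∀ a b d → d < b ∸ a → a + d < b
    +-<-∸ a b d d< = subst (_< b) (+-comm d a) (m≤o∸n⇒m+n≤o (suc d) (<⇒≤ a<b) d<)
      where a<b = m∸n≢0⇒n<m (λ e → n≮0 (subst (d <_) e d<))

  allIn⇒AllIn : ∀ a b → allIn f a b ≡ true → AllIn f a b
  allIn⇒AllIn a b e k a≤k k<b = subst (λ z → f z ≡ true) (m+[n∸m]≡n a≤k)
    (all-applyUpTo⁻ (a +_) (b ∸ a) (trans (sym (allIn-applyUpTo a b)) e) (k ∸ a) (∸-monoˡ-< k<b a≤k))

  AllIn⇒allIn : ∀ a b → AllIn f a b → allIn f a b ≡ true
  AllIn⇒allIn a b h = trans (allIn-applyUpTo a b)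
    (all-applyUpTo⁺ (a +_) (b ∸ a) (λ d d< → h (a + d) (m≤m+n a d) (+-<-∸ a b d d<)))

  allIn-empty : ∀ a b → b ≤ a → allIn f a b ≡ true
  allIn-empty a b b≤a = AllIn⇒allIn a b (λ k a≤k k<b → ⊥-elim (<⇒≱ k<b (≤-trans b≤a a≤k)))

  allIn-snoc : ∀ p i → p ≤ i → allIn f p (suc i) ≡ allIn f p i ∧ f i
  allIn-snoc p i p≤i = ≡-by-⇔
    (λ e → let h = allIn⇒AllIn p (suc i) e in
      ∧-intro (AllIn⇒allIn p i (λ k a b → h k a (m<n⇒m<1+n b))) (h i p≤i ≤-refl))
    (λ e → AllIn⇒allIn p (suc i) (λ k p≤k k≤i → extend k p≤k k≤i (allIn⇒AllIn p i (∧-conicalˡ _ _ e)) (∧-conicalʳ _ _ e)))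
    where
      extend : ∀ k → p ≤ k → k < suc i → AllIn f p i → f i ≡ true → f k ≡ true
      extend k p≤k (s≤s k≤i) h fi with m≤n⇒m<n∨m≡n k≤i
      ... | inj₁ k<i  = h k p≤k k<i
      ... | inj₂ refl = fi

  allIn-cons : ∀ s q → s < q → allIn f s q ≡ f s ∧ allIn f (suc s) q
  allIn-cons s q s<q = ≡-by-⇔
    (λ e → let h = allIn⇒AllIn s q e in
      ∧-intro (h s ≤-refl s<q) (AllIn⇒allIn (suc s) q (λ k a b → h k (<⇒≤ a) b)))
    (λ e → AllIn⇒allIn s q (λ k s≤k k<q → extend k s≤k k<q (∧-conicalˡ _ _ e) (allIn⇒AllIn (suc s) q (∧-conicalʳ _ _ e))))
    where
      extend : ∀ k → s ≤ k → k < q → f s ≡ true → AllIn f (suc s) q → f k ≡ true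
      extend k s≤k k<q fs h with m≤n⇒m<n∨m≡n s≤k
      ... | inj₁ s<k  = h k s<k k<q
      ... | inj₂ refl = fs

allIn-cong : ∀ f g a b → (∀ k → a ≤ k → k < b → f k ≡ g k) → allIn f a b ≡ allIn g a b
allIn-cong f g a b h = ≡-by-⇔
  (λ e → AllIn⇒allIn g a b (λ k p q → trans (sym (h k p q)) (allIn⇒AllIn f a b e k p q)))
  (λ e → AllIn⇒allIn f a b (λ k p q → trans (h k p q) (allIn⇒AllIn g a b e k p q)))

allIn-suc : ∀ f a b → allIn f (suc a) (suc b) ≡ allIn (f ∘ suc) a b
allIn-suc f a b = ≡-by-⇔
  (λ e → AllIn⇒allIn (f ∘ suc) a b (λ k p q → allIn⇒AllIn f (suc a) (suc b) e (suc k) (s≤s p) (s≤s q)))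
  (λ e → AllIn⇒allIn f (suc a) (suc b) (λ { (suc k) (s≤s p) (s≤s q) → allIn⇒AllIn (f ∘ suc) a b e k p q }))

leftRun-∑ : ∀ f i → suc (leftRun f i) ≡ ∑ (suc i) (λ p → 𝟙 (allIn f p i))
leftRun-∑ f zero    = refl
leftRun-∑ f (suc i) = begin
  suc (leftRun f (suc i))                                                ≡⟨ split ⟩
  ∑ (suc i) (λ p → 𝟙 (allIn f p i ∧ f i)) + 1                            ≡⟨ cong₂ _+_ snoc (cong 𝟙 (sym (allIn-empty f (suc i) (suc i) ≤-refl))) ⟩
  ∑ (suc i) (λ p → 𝟙 (allIn f p (suc i))) + 𝟙 (allIn f (suc i) (suc i))  ≡⟨ sym (∑-last (suc i) (λ p → 𝟙 (allIn f p (suc i)))) ⟩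
  ∑ (suc (suc i)) (λ p → 𝟙 (allIn f p (suc i)))                          ∎
  where
    open ≡-Reasoning
    snoc : ∑ (suc i) (λ p → 𝟙 (allIn f p i ∧ f i)) ≡ ∑ (suc i) (λ p → 𝟙 (allIn f p (suc i)))
    snoc = ∑-cong (suc i) (λ p p≤i → cong 𝟙 (sym (allIn-snoc f p i (≤-pred p≤i))))
    split : suc (leftRun f (suc i)) ≡ ∑ (suc i) (λ p → 𝟙 (allIn f p i ∧ f i)) + 1
    split with f i
    ... | true  = trans (cong suc (trans (leftRun-∑ f i) (∑-cong (suc i) {g = λ p → 𝟙 (allIn f p i ∧ true)}
                                                          (λ p _ → cong 𝟙 (sym (∧-identityʳ _))))))
                        (+-comm 1 _)
    ... | false = cong (_+ 1) (sym (∑-zero (suc i) {λ p → 𝟙 (allIn f p i ∧ false)} (λ p _ → cong 𝟙 (∧-zeroʳ _))))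

rightRun-∑ : ∀ f s fuel → suc (rightRun f s fuel) ≡ ∑ (suc fuel) (λ d → 𝟙 (allIn f s (s + d)))
rightRun-∑ f s fuel rewrite allIn-empty f s (s + 0) (≤-reflexive (+-identityʳ s)) = cong suc (tail fuel)
  where
    cons : ∀ d → allIn f s (s + suc d) ≡ f s ∧ allIn f (suc s) (suc s + d)
    cons d = trans (allIn-cons f s (s + suc d) (m<m+n s z<s)) (cong (λ z → f s ∧ allIn f (suc s) z) (+-suc s d))
    tail : ∀ fuel → rightRun f s fuel ≡ ∑ fuel (λ d → 𝟙 (allIn f s (s + suc d)))
    tail zero = refl
    tail (suc fuel) rewrite ∑-cong (suc fuel) (λ d _ → cong 𝟙 (cons d)) with f s
    ... | true  = rightRun-∑ f (suc s) fuel
    ... | false = sym (∑-zero (suc fuel) (λ _ _ → refl))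

pairCount-∑ : ∀ f N → pairCount f N ≡ ∑∑ N N (λ a b → 𝟙 ((a <ᵇ b) ∧ allIn f a b))
pairCount-∑ f N = trans (cong sum (map-upTo _ N)) (∑-cong N (λ a _ → cong sum (map-upTo _ N)))

leftRun-cong : ∀ {f g : ℕ → Bool} → (∀ k → f k ≡ g k) → ∀ i → leftRun f i ≡ leftRun g i
leftRun-cong f≗g zero    = refl
leftRun-cong f≗g (suc i) rewrite f≗g i | leftRun-cong f≗g i = refl

rightRun-cong : ∀ {f g : ℕ → Bool} → (∀ k → f k ≡ g k) → ∀ s fuel → rightRun f s fuel ≡ rightRun g s fuel
rightRun-cong f≗g s zero       = refl
rightRun-cong f≗g s (suc fuel) rewrite f≗g s | rightRun-cong f≗g (suc s) fuel = refl

pairCount-cong : ∀ {f g : ℕ → Bool} → (∀ k → f k ≡ g k) → ∀ N → pairCount f N ≡ pairCount g N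
pairCount-cong {f} {g} f≗g N = trans (pairCount-∑ f N) (trans
  (∑∑-cong N N (λ a b _ _ → cong (λ z → 𝟙 ((a <ᵇ b) ∧ z)) (allIn-cong f g a b (λ k _ _ → f≗g k))))
  (sym (pairCount-∑ g N)))

triangular : ℕ → ℕ
triangular k = suc k C 2

triangular-suc : ∀ k → triangular (suc k) ≡ suc k + triangular k
triangular-suc k = trans (sym (nCk+nC[k+1]≡[n+1]C[k+1] (suc k) 1)) (cong (_+ triangular k) (nC1≡n (suc k)))

intervalCount : (ℕ → Bool) → ℕ → ℕ
intervalCount g N = ∑∑ (suc N) (suc N) (λ a b → 𝟙 ((a <ᵇ b) ∧ allIn g a b))

prefixCount : (ℕ → Bool) → ℕ → ℕ
prefixCount g N = ∑ N (λ b → 𝟙 (allIn g 0 (suc b)))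

intervalCount-suc : ∀ g N → intervalCount g (suc N) ≡ prefixCount g (suc N) + intervalCount (g ∘ suc) N
intervalCount-suc g N = cong (prefixCount g (suc N) +_)
  (∑∑-cong (suc N) (suc N) (λ a b _ _ → cong (λ z → 𝟙 ((a <ᵇ b) ∧ z)) (allIn-suc g a b)))

prefixCount-suc : ∀ g N → prefixCount g (suc N) ≡ 𝟙 (g 0) * suc (prefixCount (g ∘ suc) N)
prefixCount-suc g N = trans
  (∑-cong (suc N) (λ b _ → trans (cong 𝟙 (trans (allIn-cons g 0 (suc b) z<s) (cong (g 0 ∧_) (allIn-suc g 0 b))))
                                  (sym (𝟙-∧ (g 0) _))))
  (∑-*ˡ (suc N) (𝟙 (g 0)) (λ b → 𝟙 (allIn (g ∘ suc) 0 b)))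

private
  runs-open : ∀ x l k → x + triangular (suc k) + suc k * l ≡ (suc l + 0) + x + triangular k + k * (suc l + 0)
  runs-open x l k rewrite triangular-suc k = shuffle x l k (triangular k)
    where
      shuffle : ∀ x l k t → x + (suc k + t) + suc k * l ≡ (suc l + 0) + x + t + k * (suc l + 0)
      shuffle = solve-∀

  runs-close : ∀ x t k → t + (x + 0 + 0) ≡ x + t + suc k * 0
  runs-close = solve-∀

-- k is the length of a run still open to the left; it merges with the initial run of g.
sum-triangular-runsAux : ∀ g N k →
  sum (map triangular (runsAux k (applyUpTo g N))) ≡ intervalCount g N + triangular k + k * prefixCount g N
sum-triangular-runsAux g zero    zero    = refl
sum-triangular-runsAux g zero    (suc k) = cong (triangular (suc k) +_) (sym (*-zeroʳ (suc k)))
sum-triangular-runsAux g (suc N) k rewrite intervalCount-suc g N | prefixCount-suc g N with g 0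
sum-triangular-runsAux g (suc N) zero    | true  =
  trans (sum-triangular-runsAux (g ∘ suc) N 1) (runs-open (intervalCount (g ∘ suc) N) (prefixCount (g ∘ suc) N) 0)
sum-triangular-runsAux g (suc N) (suc k) | true  =
  trans (sum-triangular-runsAux (g ∘ suc) N (suc (suc k))) (runs-open (intervalCount (g ∘ suc) N) (prefixCount (g ∘ suc) N) (suc k))
sum-triangular-runsAux g (suc N) zero    | false = sum-triangular-runsAux (g ∘ suc) N zero
sum-triangular-runsAux g (suc N) (suc k) | false =
  trans (cong (triangular (suc k) +_) (sum-triangular-runsAux (g ∘ suc) N zero)) (runs-close (intervalCount (g ∘ suc) N) (triangular (suc k)) k)

sum-triangular-runs : ∀ g N → sum (map triangular (runs (applyUpTo g N))) ≡ intervalCount g N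
sum-triangular-runs g N = trans (sum-triangular-runsAux g N 0) (trans (+-identityʳ _) (+-identityʳ _))

allAround : (ℕ → Bool) → ℕ → ℕ → ℕ → Bool
allAround f p q i = ((p ≤ᵇ i) ∧ allIn f p i) ∧ ((i <ᵇ q) ∧ allIn f (suc i) q)

-- The two run lengths around i count the intervals [p, q) ⊆ [0, N] around i on which f holds off i.
runs-around-∑∑ : ∀ f N i → i < N →
  suc (leftRun f i) * suc (rightRun f (suc i) (N ∸ suc i)) ≡ ∑∑ (suc N) (suc N) (λ p q → 𝟙 (allAround f p q i))
runs-around-∑∑ f N i i<N = begin
  suc (leftRun f i) * suc (rightRun f (suc i) (N ∸ suc i))  ≡⟨ cong₂ _*_ left right ⟩
  ∑ (suc N) L * ∑ (suc N) R                                 ≡⟨ sym (∑-*ʳ (suc N) (∑ (suc N) R) L) ⟩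
  ∑ (suc N) (λ p → L p * ∑ (suc N) R)                       ≡⟨ ∑-cong (suc N) (λ p _ → sym (∑-*ˡ (suc N) (L p) R)) ⟩
  ∑∑ (suc N) (suc N) (λ p q → L p * R q)                    ≡⟨ ∑∑-cong (suc N) (suc N) (λ p q _ _ → 𝟙-∧ (L′ p) (R′ q)) ⟩
  ∑∑ (suc N) (suc N) (λ p q → 𝟙 (allAround f p q i))        ∎
  where
    open ≡-Reasoning
    L′ R′ : ℕ → Bool
    L′ p = (p ≤ᵇ i) ∧ allIn f p i
    R′ q = (i <ᵇ q) ∧ allIn f (suc i) q
    L R : ℕ → ℕ
    L = 𝟙 ∘ L′
    R = 𝟙 ∘ R′
    left : suc (leftRun f i) ≡ ∑ (suc N) L
    left = begin
      suc (leftRun f i)                                               ≡⟨ leftRun-∑ f i ⟩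
      ∑ (suc i) (λ p → 𝟙 (allIn f p i))                               ≡⟨ ∑-restrict (suc i) (N ∸ i) (λ p → 𝟙 (allIn f p i)) ⟩
      ∑ (suc i + (N ∸ i)) (λ p → if p <ᵇ suc i then 𝟙 (allIn f p i) else 0)
        ≡⟨ cong (λ n → ∑ n (λ p → if p <ᵇ suc i then 𝟙 (allIn f p i) else 0)) (cong suc (m+[n∸m]≡n (<⇒≤ i<N))) ⟩
      ∑ (suc N) (λ p → if p <ᵇ suc i then 𝟙 (allIn f p i) else 0)
        ≡⟨ ∑-cong (suc N) (λ p _ → trans (if-𝟙 (p <ᵇ suc i) (allIn f p i)) (cong (λ b → 𝟙 (b ∧ allIn f p i)) (<ᵇ-suc p i))) ⟩
      ∑ (suc N) L                                                     ∎
    right : suc (rightRun f (suc i) (N ∸ suc i)) ≡ ∑ (suc N) R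
    right = begin
      suc (rightRun f (suc i) (N ∸ suc i))                            ≡⟨ rightRun-∑ f (suc i) (N ∸ suc i) ⟩
      ∑ (suc (N ∸ suc i)) (λ d → 𝟙 (allIn f (suc i) (suc i + d)))     ≡⟨ ∑-shift (suc i) (suc (N ∸ suc i)) (λ q → 𝟙 (allIn f (suc i) q)) ⟩
      ∑ (suc i + suc (N ∸ suc i)) (λ q → if suc i ≤ᵇ q then 𝟙 (allIn f (suc i) q) else 0)
        ≡⟨ cong (λ n → ∑ n (λ q → if suc i ≤ᵇ q then 𝟙 (allIn f (suc i) q) else 0))
                (trans (+-suc (suc i) (N ∸ suc i)) (cong suc (m+[n∸m]≡n i<N))) ⟩
      ∑ (suc N) (λ q → if suc i ≤ᵇ q then 𝟙 (allIn f (suc i) q) else 0)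
        ≡⟨ ∑-cong (suc N) (λ q _ → if-𝟙 (i <ᵇ q) (allIn f (suc i) q)) ⟩
      ∑ (suc N) R                                                     ∎

-- Grids

liftRel : {E : Set} → (E → E → Bool) → Maybe E → Maybe E → Bool
liftRel r (just x) (just y) = r x y
liftRel r _        _        = false

liftPred : {E : Set} → (E → Bool) → Maybe E → Bool
liftPred p (just x) = p x
liftPred p nothing  = false

Within : ℕ → ℕ → ℕ → Set
Within i k s = (i ≤ s × s ≤ k) ⊎ (k ≤ s × s ≤ i)

Gap : {E : Set} → (E → E → Bool) → (ℕ → Maybe E) → ℕ → ℕ → Set
Gap r e i k = Σ ℕ λ s → Within i k s × liftRel r (e i) (e s) ≡ true × liftRel r (e k) (e s) ≡ true

-- The strict order of a vertex seen through 0-based indices of the horizontal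
-- (hor) and vertical (ver) collisions, which are nothing out of range; orth,
-- *Gap and *Link are the consequences of good rectangularity that are used.
record Grid : Set₁ where
  field
    Carrier  : Set
    _≺_      : Carrier → Carrier → Bool
    inC₁     : Carrier → Bool
    N M      : ℕ
    hor ver  : ℕ → Maybe Carrier
    ≺-trans  : ∀ x y z → x ≺ y ≡ true → y ≺ z ≡ true → x ≺ z ≡ true
    ≺-irrefl : ∀ x → x ≺ x ≡ false
    orth     : ∀ i j → i < N → j < M →
               liftRel _≺_ (hor i) (ver j) ≡ true ⊎ liftRel _≺_ (ver j) (hor i) ≡ true
    hGap     : ∀ i k → i < N → k < N → i ≢ k →
               liftRel _≺_ (hor i) (hor k) ≡ false → liftRel _≺_ (hor k) (hor i) ≡ false → ¬ ¬ Gap _≺_ hor i k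
    vGap     : ∀ i k → i < M → k < M → i ≢ k →
               liftRel _≺_ (ver i) (ver k) ≡ false → liftRel _≺_ (ver k) (ver i) ≡ false → ¬ ¬ Gap _≺_ ver i k
    hLink    : ∀ i k → i < N → k < N → liftRel _≺_ (hor i) (hor k) ≡ true →
               (Σ ℕ λ s → s < M × liftRel _≺_ (hor i) (ver s) ≡ true × liftRel _≺_ (ver s) (hor k) ≡ true)
               ⊎ ¬ Gap _≺_ hor i k
    vLink    : ∀ i k → i < M → k < M → liftRel _≺_ (ver i) (ver k) ≡ true →
               (Σ ℕ λ s → s < N × liftRel _≺_ (ver i) (hor s) ≡ true × liftRel _≺_ (hor s) (ver k) ≡ true)
               ⊎ ¬ Gap _≺_ ver i k

transpose : Grid → Grid
transpose G = record
  { Carrier = Carrier ; _≺_ = _≺_ ; inC₁ = inC₁ ; N = M ; M = N ; hor = ver ; ver = hor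
  ; ≺-trans = ≺-trans ; ≺-irrefl = ≺-irrefl
  ; orth = λ i j i<M j<N → swap (orth j i j<N i<M)
  ; hGap = vGap ; vGap = hGap ; hLink = vLink ; vLink = hLink }
  where open Grid G

module Intervals (G : Grid) where
  open Grid G

  infix 5 _⊏_
  _⊏_ : Maybe Carrier → Maybe Carrier → Bool
  _⊏_ = liftRel _≺_

  ⊏-trans : ∀ a b d → a ⊏ b ≡ true → b ⊏ d ≡ true → a ⊏ d ≡ true
  ⊏-trans (just x) (just y) (just z) = ≺-trans x y z
  ⊏-trans (just x) (just y) nothing  _ ()
  ⊏-trans (just x) nothing  d        ()
  ⊏-trans nothing  b        d        ()

  ⊏-irrefl : ∀ a → a ⊏ a ≡ false
  ⊏-irrefl (just x) = ≺-irrefl x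
  ⊏-irrefl nothing  = refl

  ⊏-asym : ∀ a b → a ⊏ b ≡ true → b ⊏ a ≡ true → ⊥
  ⊏-asym a b e₁ e₂ = true≢false (trans (sym (⊏-trans a b a e₁ e₂)) (⊏-irrefl a))

  hLt : ℕ → ℕ → Bool
  hLt k i = hor k ⊏ hor i

  hIn : ℕ → Bool
  hIn k = liftPred inC₁ (hor k)

  DownClosed : Set
  DownClosed = ∀ x y → x ≺ y ≡ true → inC₁ y ≡ true → inC₁ x ≡ true

  downClosed : DownClosed → ∀ a b → a ⊏ b ≡ true → liftPred inC₁ b ≡ true → liftPred inC₁ a ≡ true
  downClosed dc (just x) (just y) = dc x y

  under : ℕ → ℕ → ℕ → Bool
  under a b i = (a <ᵇ b) ∧ allIn (λ k → ver k ⊏ hor i) a b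

  coord : ℕ → ℕ
  coord i = suc (leftRun (λ k → hLt k i) i) * suc (rightRun (λ k → hLt k i) (suc i) (N ∸ suc i))
          * suc (pairCount (λ k → ver k ⊏ hor i) (suc M))

  isMax : ℕ → ℕ → ℕ → Bool
  isMax p q i = allAround (λ k → hLt k i) p q i

  IsMax : ℕ → ℕ → ℕ → Set
  IsMax p q i = p ≤ i × i < q × (∀ k → p ≤ k → k < q → k ≢ i → hLt k i ≡ true)

  isMax⇒IsMax : ∀ p q i → isMax p q i ≡ true → IsMax p q i
  isMax⇒IsMax p q i e = ≤ᵇ⇒≤′ (∧-conicalˡ (p ≤ᵇ i) _ left) , <ᵇ⇒<′ (∧-conicalˡ (i <ᵇ q) _ right) , below
    where
      f = λ k → hLt k i
      left  = ∧-conicalˡ ((p ≤ᵇ i) ∧ allIn f p i) ((i <ᵇ q) ∧ allIn f (suc i) q) e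
      right = ∧-conicalʳ ((p ≤ᵇ i) ∧ allIn f p i) ((i <ᵇ q) ∧ allIn f (suc i) q) e
      below : ∀ k → p ≤ k → k < q → k ≢ i → hLt k i ≡ true
      below k p≤k k<q k≢i with <-cmp k i
      ... | tri< k<i _ _ = allIn⇒AllIn f p i (∧-conicalʳ (p ≤ᵇ i) _ left) k p≤k k<i
      ... | tri≈ _ k≡i _ = ⊥-elim (k≢i k≡i)
      ... | tri> _ _ i<k = allIn⇒AllIn f (suc i) q (∧-conicalʳ (i <ᵇ q) _ right) k i<k k<q

  IsMax⇒isMax : ∀ p q i → IsMax p q i → isMax p q i ≡ true
  IsMax⇒isMax p q i (p≤i , i<q , below) = ∧-intro
    (∧-intro (≤⇒≤ᵇ′ p≤i) (AllIn⇒allIn _ p i (λ k p≤k k<i → below k p≤k (<-trans k<i i<q) (<⇒≢ k<i))))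
    (∧-intro (<⇒<ᵇ′ i<q) (AllIn⇒allIn _ (suc i) q (λ k i<k k<q → below k (≤-trans p≤i (<⇒≤ i<k)) k<q (≢-sym (<⇒≢ i<k)))))

  isMax-empty : ∀ p q i → ¬ p < q → isMax p q i ≡ false
  isMax-empty p q i p≮q with isMax p q i in eq
  ... | false = refl
  ... | true  = let (p≤i , i<q , _) = isMax⇒IsMax p q i eq in ⊥-elim (p≮q (≤-<-trans p≤i i<q))

  IsMax-unique : ∀ p q i i′ → IsMax p q i → IsMax p q i′ → i ≡ i′
  IsMax-unique p q i i′ (p≤i , i<q , below) (p≤i′ , i′<q , below′) with i ≟ i′
  ... | yes i≡i′ = i≡i′
  ... | no  i≢i′ = ⊥-elim (⊏-asym (hor i) (hor i′) (below′ i p≤i i<q i≢i′) (below i′ p≤i′ i′<q (≢-sym i≢i′)))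

  IsMax⇒< : ∀ {p q i} → IsMax p q i → q ≤ N → i < N
  IsMax⇒< (_ , i<q , _) q≤N = <-≤-trans i<q q≤N

  IsMax-below : ∀ {p q i} → IsMax p q i → ∀ k → p ≤ k → k < q → k ≡ i ⊎ hLt k i ≡ true
  IsMax-below {i = i} (_ , _ , below) k p≤k k<q with k ≟ i
  ... | yes k≡i = inj₁ k≡i
  ... | no  k≢i = inj₂ (below k p≤k k<q k≢i)

  ∑-isMax : ∀ p q i (h : ℕ → ℕ) → IsMax p q i → q ≤ N → ∑ N (λ k → 𝟙 (isMax p q k) * h k) ≡ h i
  ∑-isMax p q i h m q≤N =
    trans (∑-single N i (IsMax⇒< m q≤N) others)
          (trans (cong (λ b → 𝟙 b * h i) (IsMax⇒isMax p q i m)) (+-identityʳ _))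
    where
      others : ∀ k → k < N → k ≢ i → 𝟙 (isMax p q k) * h k ≡ 0
      others k _ k≢i with isMax p q k in eq
      ... | false = refl
      ... | true  = ⊥-elim (k≢i (IsMax-unique p q k i (isMax⇒IsMax p q k eq) m))

  ∑-isMax-empty : ∀ p q (h : ℕ → ℕ) → ¬ p < q → ∑ N (λ k → 𝟙 (isMax p q k) * h k) ≡ 0
  ∑-isMax-empty p q h p≮q = ∑-zero N (λ k _ → cong (λ b → 𝟙 b * h k) (isMax-empty p q k p≮q))

  IsMax-extend : ∀ p q i → q < N → IsMax p q i → Σ ℕ (IsMax p (suc q))
  IsMax-extend p q i q<N m@(p≤i , i<q , below) with hLt q i in q⊏i | hLt i q in i⊏q
  ... | true | _ = i , p≤i , m<n⇒m<1+n i<q , below′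
    where
      below′ : ∀ k → p ≤ k → k < suc q → k ≢ i → hLt k i ≡ true
      below′ k p≤k (s≤s k≤q) k≢i with m≤n⇒m<n∨m≡n k≤q
      ... | inj₁ k<q  = below k p≤k k<q k≢i
      ... | inj₂ refl = q⊏i
  ... | false | true = q , ≤-trans p≤i (<⇒≤ i<q) , ≤-refl , below′
    where
      below′ : ∀ k → p ≤ k → k < suc q → k ≢ q → hLt k q ≡ true
      below′ k p≤k (s≤s k≤q) k≢q with m≤n⇒m<n∨m≡n k≤q | IsMax-below m k p≤k
      ... | inj₂ k≡q  | _ = ⊥-elim (k≢q k≡q)
      ... | inj₁ k<q  | k≤i with k≤i k<q
      ...   | inj₁ refl = i⊏q
      ...   | inj₂ k⊏i  = ⊏-trans (hor k) (hor i) (hor q) k⊏i i⊏q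
  ... | false | false = ⊥-elim (hGap i q (<-trans i<q q<N) q<N (<⇒≢ i<q) i⊏q q⊏i noGap)
    where
      -- strictly between i and q everything lies below the maximum i
      noGap : ¬ Gap _≺_ hor i q
      noGap (s , inj₂ (q≤s , s≤i) , _ , _) = <⇒≱ i<q (≤-trans q≤s s≤i)
      noGap (s , inj₁ (i≤s , s≤q) , i⊏s , q⊏s) with m≤n⇒m<n∨m≡n i≤s | m≤n⇒m<n∨m≡n s≤q
      ... | inj₂ refl | _         = true≢false (trans (sym i⊏s) (⊏-irrefl (hor i)))
      ... | inj₁ _    | inj₂ refl = true≢false (trans (sym q⊏s) (⊏-irrefl (hor q)))
      ... | inj₁ i<s  | inj₁ s<q  =
        ⊏-asym (hor s) (hor i) (below s (≤-trans p≤i (<⇒≤ i<s)) s<q (≢-sym (<⇒≢ i<s))) i⊏s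

  IsMax-exists : ∀ p q → p < q → q ≤ N → Σ ℕ (IsMax p q)
  IsMax-exists p (suc q) (s≤s p≤q) q<N with m≤n⇒m<n∨m≡n p≤q
  ... | inj₂ refl = p , ≤-refl , ≤-refl , λ k p≤k k<sp k≢p → ⊥-elim (k≢p (≤-antisym (≤-pred k<sp) p≤k))
  ... | inj₁ p<q  = IsMax-extend p q _ q<N (proj₂ (IsMax-exists p q p<q (<⇒≤ q<N)))

  belowCount : ℕ → ℕ
  belowCount i = ∑∑ (suc M) (suc M) (λ a b → 𝟙 (under a b i))

  -- W₁ W₂ counts the intervals [p, q) whose strict maximum is l_i, and T = 1 + belowCount i.
  coord-∑∑ : ∀ i → i < N → coord i ≡ ∑∑ (suc N) (suc N) (λ p q → 𝟙 (isMax p q i)) * suc (belowCount i)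
  coord-∑∑ i i<N = cong₂ _*_ (runs-around-∑∑ (λ k → hLt k i) N i i<N)
                             (cong suc (pairCount-∑ (λ k → ver k ⊏ hor i) (suc M)))

  coordSum : ℕ
  coordSum = ∑ N (λ i → 𝟙 (hIn i) * coord i)

  maxIn : ℕ → ℕ → ℕ
  maxIn p q = ∑ N (λ i → 𝟙 (isMax p q i) * 𝟙 (hIn i))

  crossMax : ℕ → ℕ → ℕ → ℕ → ℕ
  crossMax p q a b = ∑ N (λ i → 𝟙 (isMax p q i) * (𝟙 (hIn i) * 𝟙 (under a b i)))

  private
    term : ℕ → ℕ → ℕ → ℕ
    term p q i = 𝟙 (isMax p q i) * (𝟙 (hIn i) * suc (belowCount i))

    coordTerm : ∀ i → i < N → 𝟙 (hIn i) * coord i ≡ ∑∑ (suc N) (suc N) (λ p q → term p q i)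
    coordTerm i i<N = begin
      h * coord i                                        ≡⟨ cong (h *_) (coord-∑∑ i i<N) ⟩
      h * (∑∑ (suc N) (suc N) X * suc (belowCount i))    ≡⟨ solve-swap h (∑∑ (suc N) (suc N) X) (suc (belowCount i)) ⟩
      ∑∑ (suc N) (suc N) X * (h * suc (belowCount i))    ≡⟨ ∑∑-*ʳ (suc N) (suc N) (h * suc (belowCount i)) X ⟩
      ∑∑ (suc N) (suc N) (λ p q → term p q i)            ∎
      where
        open ≡-Reasoning
        h = 𝟙 (hIn i)
        X = λ p q → 𝟙 (isMax p q i)
        solve-swap : ∀ a x s → a * (x * s) ≡ x * (a * s)
        solve-swap = solve-∀

    termSplit : ∀ p q i → term p q i
              ≡ 𝟙 (isMax p q i) * 𝟙 (hIn i)
                + ∑∑ (suc M) (suc M) (λ a b → 𝟙 (isMax p q i) * (𝟙 (hIn i) * 𝟙 (under a b i)))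
    termSplit p q i = begin
      x * (h * suc B)                     ≡⟨ cong (x *_) (*-suc h B) ⟩
      x * (h + h * B)                     ≡⟨ *-distribˡ-+ x h (h * B) ⟩
      x * h + x * (h * B)                 ≡⟨ cong (λ z → x * h + x * z) (∑∑-*ˡ (suc M) (suc M) h U) ⟩
      x * h + x * ∑∑ (suc M) (suc M) (λ a b → h * U a b)
                                          ≡⟨ cong (x * h +_) (∑∑-*ˡ (suc M) (suc M) x (λ a b → h * U a b)) ⟩
      x * h + ∑∑ (suc M) (suc M) (λ a b → x * (h * U a b)) ∎
      where
        open ≡-Reasoning
        x = 𝟙 (isMax p q i)
        h = 𝟙 (hIn i)
        B = belowCount i
        U = λ a b → 𝟙 (under a b i)

    intervalTerm : ∀ p q → ∑ N (term p q) ≡ maxIn p q + ∑∑ (suc M) (suc M) (crossMax p q)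
    intervalTerm p q =
      trans (∑-cong N (λ i _ → termSplit p q i))
     (trans (∑-distrib-+ N (λ i → 𝟙 (isMax p q i) * 𝟙 (hIn i)) _)
            (cong (maxIn p q +_) (∑-∑∑-swap N (suc M) (suc M) (λ i a b → 𝟙 (isMax p q i) * (𝟙 (hIn i) * 𝟙 (under a b i))))))

  coordSum-∑∑ : coordSum ≡ ∑∑ (suc N) (suc N) maxIn + ∑∑ (suc N) (suc N) (λ p q → ∑∑ (suc M) (suc M) (crossMax p q))
  coordSum-∑∑ = begin
    coordSum                                                      ≡⟨ ∑-cong N coordTerm ⟩
    ∑ N (λ i → ∑∑ (suc N) (suc N) (λ p q → term p q i))           ≡⟨ ∑-∑∑-swap N (suc N) (suc N) (λ i p q → term p q i) ⟩
    ∑∑ (suc N) (suc N) (λ p q → ∑ N (term p q))                   ≡⟨ ∑∑-cong (suc N) (suc N) (λ p q _ _ → intervalTerm p q) ⟩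
    ∑∑ (suc N) (suc N) (λ p q → maxIn p q + ∑∑ (suc M) (suc M) (crossMax p q))
                                                                  ≡⟨ ∑∑-distrib-+ (suc N) (suc N) maxIn (λ p q → ∑∑ (suc M) (suc M) (crossMax p q)) ⟩
    ∑∑ (suc N) (suc N) maxIn + ∑∑ (suc N) (suc N) (λ p q → ∑∑ (suc M) (suc M) (crossMax p q)) ∎
    where open ≡-Reasoning

  crossMax-emptyˡ : ∀ {p q} a b → ¬ p < q → crossMax p q a b ≡ 0
  crossMax-emptyˡ {p} {q} a b p≮q = ∑-isMax-empty p q (λ i → 𝟙 (hIn i) * 𝟙 (under a b i)) p≮q

  crossMax-emptyʳ : ∀ p q {a b} → ¬ a < b → crossMax p q a b ≡ 0
  crossMax-emptyʳ p q {a} {b} a≮b = ∑-zero N (λ i _ →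
    trans (cong (λ u → 𝟙 (isMax p q i) * (𝟙 (hIn i) * 𝟙 (u ∧ allIn (λ k → ver k ⊏ hor i) a b))) (≮⇒<ᵇ≡false a≮b))
          (trans (cong (𝟙 (isMax p q i) *_) (*-zeroʳ (𝟙 (hIn i)))) (*-zeroʳ (𝟙 (isMax p q i)))))

  allC₁ : ℕ → ℕ → ℕ
  allC₁ p q = 𝟙 ((p <ᵇ q) ∧ allIn hIn p q)

  allC₁-nonempty : ∀ {p q} → p < q → allC₁ p q ≡ 𝟙 (allIn hIn p q)
  allC₁-nonempty p<q rewrite <⇒<ᵇ′ p<q = refl

  allC₁-empty : ∀ {p q} → ¬ p < q → allC₁ p q ≡ 0
  allC₁-empty p≮q rewrite ≮⇒<ᵇ≡false p≮q = refl

  maxIn-empty : ∀ {p q} → ¬ p < q → maxIn p q ≡ 0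
  maxIn-empty {p} {q} p≮q = ∑-isMax-empty p q (λ i → 𝟙 (hIn i)) p≮q

  allC₁≤maxIn : ∀ p q → q ≤ N → allC₁ p q ≤ maxIn p q
  allC₁≤maxIn p q q≤N with p <? q
  ... | no  p≮q = ≤-reflexive (trans (allC₁-empty p≮q) (sym (maxIn-empty p≮q)))
  ... | yes p<q with IsMax-exists p q p<q q≤N
  ... | i , m@(p≤i , i<q , _) =
    subst₂ _≤_ (sym (allC₁-nonempty p<q)) (sym (∑-isMax p q i (λ i → 𝟙 (hIn i)) m q≤N))
           (𝟙-mono (λ e → allIn⇒AllIn hIn p q e i p≤i i<q))

  -- In a down-closed C₁ an interval lies in C₁ as soon as its maximum does.
  allC₁≡maxIn : DownClosed → ∀ p q → q ≤ N → allC₁ p q ≡ maxIn p q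
  allC₁≡maxIn dc p q q≤N with p <? q
  ... | no  p≮q = trans (allC₁-empty p≮q) (sym (maxIn-empty p≮q))
  ... | yes p<q with IsMax-exists p q p<q q≤N
  ... | i , m@(p≤i , i<q , _) =
    trans (allC₁-nonempty p<q)
          (trans (cong 𝟙 (≡-by-⇔ (λ e → allIn⇒AllIn hIn p q e i p≤i i<q) fromMax))
                 (sym (∑-isMax p q i (λ i → 𝟙 (hIn i)) m q≤N)))
    where
      fromMax : hIn i ≡ true → allIn hIn p q ≡ true
      fromMax e = AllIn⇒allIn hIn p q (λ k p≤k k<q → downFromMax k (IsMax-below m k p≤k k<q))
        where
          downFromMax : ∀ k → k ≡ i ⊎ hLt k i ≡ true → hIn k ≡ true
          downFromMax k (inj₁ refl) = e
          downFromMax k (inj₂ k⊏i)  = downClosed dc (hor k) (hor i) k⊏i e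

  allC₁-outside : ∀ {p q k} → p ≤ k → k < q → hIn k ≡ false → allC₁ p q ≡ 0
  allC₁-outside {p} {q} {k} p≤k k<q out with allIn hIn p q in eq
  ... | true  = ⊥-elim (true≢false (trans (sym (allIn⇒AllIn hIn p q eq k p≤k k<q)) out))
  ... | false rewrite <⇒<ᵇ′ (≤-<-trans p≤k k<q) = refl

  IsMax-singleton : ∀ i → IsMax i (suc i) i
  IsMax-singleton i = ≤-refl , ≤-refl , λ k i≤k k<si k≢i → ⊥-elim (k≢i (≤-antisym (≤-pred k<si) i≤k))

  -- Any other maximum would be a gap between i and k.
  IsMax-noGap : ∀ {i k p q} → hLt i k ≡ true → ¬ Gap _≺_ hor i k → p < q → q ≤ N →
                p ≤ i → i < q → p ≤ k → k < q → (∀ m → p ≤ m → m < q → Within i k m) → IsMax p q k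
  IsMax-noGap {i} {k} {p} {q} i⊏k noGap p<q q≤N p≤i i<q p≤k k<q within with IsMax-exists p q p<q q≤N
  ... | m , mm@(p≤m , m<q , below) = subst (IsMax p q) m≡k mm
    where
      m≡k : m ≡ k
      m≡k with m ≟ k | m ≟ i
      ... | yes m≡k | _        = m≡k
      ... | no  m≢k | yes refl = ⊥-elim (⊏-asym (hor m) (hor k) i⊏k (below k p≤k k<q (≢-sym m≢k)))
      ... | no  m≢k | no  m≢i  =
        ⊥-elim (noGap (m , within m p≤m m<q , below i p≤i i<q (≢-sym m≢i) , below k p≤k k<q (≢-sym m≢k)))

  IsMax-span : ∀ i k → i < N → k < N → hLt i k ≡ true → ¬ Gap _≺_ hor i k →
               Σ ℕ λ p → Σ ℕ λ q → IsMax p q k × p ≤ i × i < q × q ≤ N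
  IsMax-span i k i<N k<N i⊏k noGap with <-cmp i k
  ... | tri≈ _ refl _ = ⊥-elim (true≢false (trans (sym i⊏k) (⊏-irrefl (hor i))))
  ... | tri< i<k _ _ =
    i , suc k , IsMax-noGap i⊏k noGap i<sk k<N ≤-refl i<sk (<⇒≤ i<k) ≤-refl
                  (λ m i≤m m<sk → inj₁ (i≤m , ≤-pred m<sk)) , ≤-refl , i<sk , k<N
    where i<sk = m<n⇒m<1+n i<k
  ... | tri> _ _ k<i =
    k , suc i , IsMax-noGap i⊏k noGap k<si i<N (<⇒≤ k<i) ≤-refl ≤-refl k<si
                  (λ m k≤m m<si → inj₂ (k≤m , ≤-pred m<si)) , <⇒≤ k<i , ≤-refl , i<N
    where k<si = m<n⇒m<1+n k<i

  Violation : Maybe Carrier → Maybe Carrier → Set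
  Violation a b = a ⊏ b ≡ true × liftPred inC₁ a ≡ false × liftPred inC₁ b ≡ true

module Pairs (G : Grid) where
  open Grid G
  private
    module I = Intervals G
    module J = Intervals (transpose G)
  open I using (_⊏_)

  under-split : ∀ {p q a b i j} → I.IsMax p q i → J.IsMax a b j → hor i ⊏ ver j ≡ true →
                I.under a b i ≡ false × J.under p q j ≡ true
  under-split {p} {q} {a} {b} {i} {j} mi@(p≤i , i<q , _) (a≤j , j<b , _) e = notUnder , under
    where
      notUnder : I.under a b i ≡ false
      notUnder with I.under a b i in eq
      ... | false = refl
      ... | true  = ⊥-elim (I.⊏-asym (hor i) (ver j) e
                      (allIn⇒AllIn _ a b (∧-conicalʳ (a <ᵇ b) _ eq) j a≤j j<b))
      under : J.under p q j ≡ true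
      under = ∧-intro (<⇒<ᵇ′ (≤-<-trans p≤i i<q))
                      (AllIn⇒allIn _ p q (λ k p≤k k<q → belowTop k (I.IsMax-below mi k p≤k k<q)))
        where
          belowTop : ∀ k → k ≡ i ⊎ I.hLt k i ≡ true → hor k ⊏ ver j ≡ true
          belowTop k (inj₁ refl) = e
          belowTop k (inj₂ k⊏i)  = I.⊏-trans (hor k) (hor i) (ver j) k⊏i e

  crossMax-upper : ∀ {p q a b i j} → I.IsMax p q i → J.IsMax a b j → q ≤ N → b ≤ M → hor i ⊏ ver j ≡ true →
                   I.crossMax p q a b + J.crossMax a b p q ≡ 𝟙 (J.hIn j)
  crossMax-upper {p} {q} {a} {b} {i} {j} mi mj q≤N b≤M e = begin
    I.crossMax p q a b + J.crossMax a b p q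
      ≡⟨ cong₂ _+_ (I.∑-isMax p q i (λ k → 𝟙 (I.hIn k) * 𝟙 (I.under a b k)) mi q≤N)
                   (J.∑-isMax a b j (λ k → 𝟙 (J.hIn k) * 𝟙 (J.under p q k)) mj b≤M) ⟩
    𝟙 (I.hIn i) * 𝟙 (I.under a b i) + 𝟙 (J.hIn j) * 𝟙 (J.under p q j)
      ≡⟨ cong₂ (λ u w → 𝟙 (I.hIn i) * 𝟙 u + 𝟙 (J.hIn j) * 𝟙 w) (proj₁ split) (proj₂ split) ⟩
    𝟙 (I.hIn i) * 0 + 𝟙 (J.hIn j) * 1
      ≡⟨ cong₂ _+_ (*-zeroʳ (𝟙 (I.hIn i))) (*-identityʳ (𝟙 (J.hIn j))) ⟩
    𝟙 (J.hIn j) ∎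
    where
      open ≡-Reasoning
      split = under-split mi mj e

  allC₁-product-upper : I.DownClosed → ∀ {p q a b i j} → I.IsMax p q i → J.IsMax a b j → hor i ⊏ ver j ≡ true →
                        𝟙 (allIn I.hIn p q) * 𝟙 (allIn J.hIn a b) ≡ 𝟙 (J.hIn j)
  allC₁-product-upper dc {p} {q} {a} {b} {i} {j} mi mj@(a≤j , j<b , _) e =
    trans (𝟙-∧ (allIn I.hIn p q) (allIn J.hIn a b))
          (cong 𝟙 (≡-by-⇔ (λ both → allIn⇒AllIn J.hIn a b (∧-conicalʳ (allIn I.hIn p q) _ both) j a≤j j<b)
                          (λ top → ∧-intro (horizontal top) (vertical top))))
    where
      horizontal : J.hIn j ≡ true → allIn I.hIn p q ≡ true
      horizontal top = AllIn⇒allIn I.hIn p q (λ k p≤k k<q →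
        I.downClosed dc (hor k) (ver j) (allIn⇒AllIn _ p q (∧-conicalʳ (p <ᵇ q) _ (proj₂ (under-split mi mj e))) k p≤k k<q) top)
      vertical : J.hIn j ≡ true → allIn J.hIn a b ≡ true
      vertical top = AllIn⇒allIn J.hIn a b (λ k a≤k k<b → belowTop k (J.IsMax-below mj k a≤k k<b))
        where
          belowTop : ∀ k → k ≡ j ⊎ J.hLt k j ≡ true → J.hIn k ≡ true
          belowTop k (inj₁ refl) = top
          belowTop k (inj₂ k⊏j)  = I.downClosed dc (ver k) (ver j) k⊏j top

module Totals (G : Grid) where
  open Grid G
  private
    module I = Intervals G
    module J = Intervals (transpose G)
  open I using (_⊏_)

  LHS RHS : ℕ
  LHS = I.coordSum + J.coordSum
  RHS = intervalCount I.hIn N + intervalCount J.hIn M + intervalCount I.hIn N * intervalCount J.hIn M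

  cross : ℕ → ℕ → ℕ → ℕ → ℕ
  cross p q a b = I.crossMax p q a b + J.crossMax a b p q

  cross-atMax : ∀ {p q a b i j} → I.IsMax p q i → J.IsMax a b j → q ≤ N → b ≤ M →
                (hor i ⊏ ver j ≡ true × cross p q a b ≡ 𝟙 (J.hIn j))
                ⊎ (ver j ⊏ hor i ≡ true × cross p q a b ≡ 𝟙 (I.hIn i))
  cross-atMax {p} {q} {a} {b} mi mj q≤N b≤M with orth _ _ (I.IsMax⇒< mi q≤N) (J.IsMax⇒< mj b≤M)
  ... | inj₁ e = inj₁ (e , Pairs.crossMax-upper G mi mj q≤N b≤M e)
  ... | inj₂ e = inj₂ (e , trans (+-comm (I.crossMax p q a b) _) (Pairs.crossMax-upper (transpose G) mj mi b≤M q≤N e))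

  allC₁-product≤cross : ∀ p q a b → q ≤ N → b ≤ M → I.allC₁ p q * J.allC₁ a b ≤ cross p q a b
  allC₁-product≤cross p q a b q≤N b≤M with p <? q | a <? b
  ... | no p≮q  | _       rewrite I.allC₁-empty p≮q = z≤n
  ... | yes _   | no a≮b  rewrite J.allC₁-empty a≮b | *-zeroʳ (I.allC₁ p q) = z≤n
  ... | yes p<q | yes a<b with I.IsMax-exists p q p<q q≤N | J.IsMax-exists a b a<b b≤M
  ... | i , mi@(p≤i , i<q , _) | j , mj@(a≤j , j<b , _)
    rewrite I.allC₁-nonempty p<q | J.allC₁-nonempty a<b with cross-atMax mi mj q≤N b≤M
  ... | inj₁ (_ , eq) rewrite eq =
    ≤-trans (𝟙-*-≤ʳ (allIn I.hIn p q) _) (𝟙-mono (λ e → allIn⇒AllIn J.hIn a b e j a≤j j<b))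
  ... | inj₂ (_ , eq) rewrite eq =
    ≤-trans (𝟙-*-≤ˡ (allIn I.hIn p q) _) (𝟙-mono (λ e → allIn⇒AllIn I.hIn p q e i p≤i i<q))

  allC₁-product≡cross : I.DownClosed → ∀ p q a b → q ≤ N → b ≤ M → I.allC₁ p q * J.allC₁ a b ≡ cross p q a b
  allC₁-product≡cross dc p q a b q≤N b≤M with p <? q | a <? b
  ... | no p≮q  | _       rewrite I.allC₁-empty p≮q | I.crossMax-emptyˡ a b p≮q | J.crossMax-emptyʳ a b p≮q = refl
  ... | yes _   | no a≮b  rewrite J.allC₁-empty a≮b | *-zeroʳ (I.allC₁ p q)
                                | I.crossMax-emptyʳ p q a≮b | J.crossMax-emptyˡ p q a≮b = refl
  ... | yes p<q | yes a<b with I.IsMax-exists p q p<q q≤N | J.IsMax-exists a b a<b b≤M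
  ... | i , mi | j , mj rewrite I.allC₁-nonempty p<q | J.allC₁-nonempty a<b with cross-atMax mi mj q≤N b≤M
  ... | inj₁ (e , eq) = trans (Pairs.allC₁-product-upper G dc mi mj e) (sym eq)
  ... | inj₂ (e , eq) = trans (*-comm (𝟙 (allIn I.hIn p q)) _)
                              (trans (Pairs.allC₁-product-upper (transpose G) dc mj mi e) (sym eq))

  private
    X Y Z R : ℕ
    X = ∑∑ (suc N) (suc N) I.maxIn
    Y = ∑∑ (suc M) (suc M) J.maxIn
    Z = ∑∑ (suc N) (suc N) (λ p q → ∑∑ (suc M) (suc M) (cross p q))
    R = ∑∑ (suc N) (suc N) (λ p q → ∑∑ (suc M) (suc M) (λ a b → I.allC₁ p q * J.allC₁ a b))

    LHS-split : LHS ≡ (X + Y) + Z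
    LHS-split = begin
      I.coordSum + J.coordSum
        ≡⟨ cong₂ _+_ I.coordSum-∑∑ J.coordSum-∑∑ ⟩
      (X + H) + (Y + V)
        ≡⟨ interchange X H Y V ⟩
      (X + Y) + (H + V)
        ≡⟨ cong (λ v → (X + Y) + (H + v)) (∑∑-swap (suc M) (suc M) (suc N) (suc N) (λ a b p q → J.crossMax a b p q)) ⟩
      (X + Y) + (H + ∑∑ (suc N) (suc N) (λ p q → ∑∑ (suc M) (suc M) (λ a b → J.crossMax a b p q)))
        ≡⟨ cong ((X + Y) +_) (sym (trans (∑∑-cong (suc N) (suc N) (λ p q _ _ →
               ∑∑-distrib-+ (suc M) (suc M) (I.crossMax p q) (λ a b → J.crossMax a b p q)))
               (∑∑-distrib-+ (suc N) (suc N) (λ p q → ∑∑ (suc M) (suc M) (I.crossMax p q))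
                                             (λ p q → ∑∑ (suc M) (suc M) (λ a b → J.crossMax a b p q))))) ⟩
      (X + Y) + Z ∎
      where
        open ≡-Reasoning
        H = ∑∑ (suc N) (suc N) (λ p q → ∑∑ (suc M) (suc M) (I.crossMax p q))
        V = ∑∑ (suc M) (suc M) (λ a b → ∑∑ (suc N) (suc N) (J.crossMax a b))

    RHS-split : RHS ≡ (intervalCount I.hIn N + intervalCount J.hIn M) + R
    RHS-split = cong (intervalCount I.hIn N + intervalCount J.hIn M +_)
      (trans (∑∑-*ʳ (suc N) (suc N) (intervalCount J.hIn M) I.allC₁)
             (∑∑-cong (suc N) (suc N) (λ p q _ _ → ∑∑-*ˡ (suc M) (suc M) (I.allC₁ p q) J.allC₁)))

    X≥ : intervalCount I.hIn N ≤ X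
    X≥ = ∑∑-mono-≤ (suc N) (suc N) (λ p q _ q≤N → I.allC₁≤maxIn p q (≤-pred q≤N))

    Y≥ : intervalCount J.hIn M ≤ Y
    Y≥ = ∑∑-mono-≤ (suc M) (suc M) (λ a b _ b≤M → J.allC₁≤maxIn a b (≤-pred b≤M))

    Z≥-term : ∀ p q → q < suc N → ∑∑ (suc M) (suc M) (λ a b → I.allC₁ p q * J.allC₁ a b) ≤ ∑∑ (suc M) (suc M) (cross p q)
    Z≥-term p q q≤N = ∑∑-mono-≤ (suc M) (suc M) (λ a b _ b≤M → allC₁-product≤cross p q a b (≤-pred q≤N) (≤-pred b≤M))

    Z≥ : R ≤ Z
    Z≥ = ∑∑-mono-≤ (suc N) (suc N) (λ p q _ q≤N → Z≥-term p q q≤N)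

  LHS≡RHS : I.DownClosed → LHS ≡ RHS
  LHS≡RHS dc = trans LHS-split (trans (cong₂ _+_ (cong₂ _+_ X≡ Y≡) Z≡) (sym RHS-split))
    where
      X≡ = sym (∑∑-cong (suc N) (suc N) (λ p q _ q≤N → I.allC₁≡maxIn dc p q (≤-pred q≤N)))
      Y≡ = sym (∑∑-cong (suc M) (suc M) (λ a b _ b≤M → J.allC₁≡maxIn dc a b (≤-pred b≤M)))
      Z≡ = sym (∑∑-cong (suc N) (suc N) (λ p q _ q≤N → ∑∑-cong (suc M) (suc M) (λ a b _ b≤M →
             allC₁-product≡cross dc p q a b (≤-pred q≤N) (≤-pred b≤M))))

  RHS<LHS-byMaxIn : ∀ p q → p < q → q ≤ N → I.allC₁ p q < I.maxIn p q → RHS < LHS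
  RHS<LHS-byMaxIn p q p<q q≤N lt = subst₂ _<_ (sym RHS-split) (sym LHS-split)
    (+-mono-<-≤ (+-mono-<-≤ (∑∑-mono-< (suc N) (suc N) (λ p q _ q≤N → I.allC₁≤maxIn p q (≤-pred q≤N))
                               p q (s≤s (<⇒≤ (<-≤-trans p<q q≤N))) (s≤s q≤N) lt) Y≥) Z≥)

  RHS<LHS-byCross : ∀ p q a b → p ≤ N → q ≤ N → a ≤ M → b ≤ M →
                    I.allC₁ p q * J.allC₁ a b < cross p q a b → RHS < LHS
  RHS<LHS-byCross p q a b p≤N q≤N a≤M b≤M lt = subst₂ _<_ (sym RHS-split) (sym LHS-split)
    (+-mono-≤-< (+-mono-≤ X≥ Y≥)
      (∑∑-mono-< (suc N) (suc N) (λ p q _ q≤N → Z≥-term p q q≤N) p q (s≤s p≤N) (s≤s q≤N)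
        (∑∑-mono-< (suc M) (suc M) (λ a b _ b≤M → allC₁-product≤cross p q a b q≤N (≤-pred b≤M))
                   a b (s≤s a≤M) (s≤s b≤M) lt)))

  RHS<LHS-hv : ∀ i j → i < N → j < M → I.Violation (hor i) (ver j) → RHS < LHS
  RHS<LHS-hv i j i<N j<M (i⊏j , notIn , isIn) =
    RHS<LHS-byCross i (suc i) j (suc j) (<⇒≤ i<N) i<N (<⇒≤ j<M) j<M lt
    where
      lt : I.allC₁ i (suc i) * J.allC₁ j (suc j) < cross i (suc i) j (suc j)
      lt rewrite I.allC₁-outside ≤-refl ≤-refl notIn
        with cross-atMax (I.IsMax-singleton i) (J.IsMax-singleton j) i<N j<M
      ... | inj₁ (_ , eq)   rewrite eq | isIn = s≤s z≤n
      ... | inj₂ (j⊏i , _) = ⊥-elim (I.⊏-asym (hor i) (ver j) i⊏j j⊏i)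

  RHS<LHS-byMax : ∀ {p q i k} → q ≤ N → I.IsMax p q k → p ≤ i → i < q → I.Violation (hor i) (hor k) → RHS < LHS
  RHS<LHS-byMax {p} {q} {i} {k} q≤N mk p≤i i<q (_ , notIn , isIn) =
    RHS<LHS-byMaxIn p q (≤-<-trans p≤i i<q) q≤N
      (subst₂ _<_ (sym (I.allC₁-outside p≤i i<q notIn))
                  (sym (trans (I.∑-isMax p q k (λ i → 𝟙 (I.hIn i)) mk q≤N) (cong 𝟙 isIn))) (s≤s z≤n))

LHS-transpose : ∀ G → Totals.LHS (transpose G) ≡ Totals.LHS G
LHS-transpose G = +-comm (Intervals.coordSum (transpose G)) (Intervals.coordSum G)

RHS-transpose : ∀ G → Totals.RHS (transpose G) ≡ Totals.RHS G
RHS-transpose G = cong₂ _+_ (+-comm x y) (*-comm x y)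
  where
    x = intervalCount (Intervals.hIn (transpose G)) (Grid.M G)
    y = intervalCount (Intervals.hIn G) (Grid.N G)

module Violations (G : Grid) where
  open Grid G
  open Totals G using (LHS; RHS)
  private
    module I = Intervals G

  transposed : Totals.RHS (transpose G) < Totals.LHS (transpose G) → RHS < LHS
  transposed = subst₂ _<_ (RHS-transpose G) (LHS-transpose G)

  RHS<LHS-vh : ∀ j i → j < M → i < N → I.Violation (ver j) (hor i) → RHS < LHS
  RHS<LHS-vh j i j<M i<N v = transposed (Totals.RHS<LHS-hv (transpose G) j i j<M i<N v)

  RHS<LHS-hh : ∀ i k → i < N → k < N → I.Violation (hor i) (hor k) → RHS < LHS
  RHS<LHS-hh i k i<N k<N v@(i⊏k , notIn , isIn) with hLink i k i<N k<N i⊏k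
  ... | inj₂ noGap =
    let (p , q , mk , p≤i , i<q , q≤N) = I.IsMax-span i k i<N k<N i⊏k noGap
    in Totals.RHS<LHS-byMax G q≤N mk p≤i i<q v
  ... | inj₁ (s , s<M , i⊏s , s⊏k) with liftPred inC₁ (ver s) in s-in
  ...   | true  = Totals.RHS<LHS-hv G i s i<N s<M (i⊏s , notIn , s-in)
  ...   | false = RHS<LHS-vh s k s<M k<N (s⊏k , s-in , isIn)

RHS<LHS-vv : ∀ G j k → j < Grid.M G → k < Grid.M G → Intervals.Violation G (Grid.ver G j) (Grid.ver G k) →
             Totals.RHS G < Totals.LHS G
RHS<LHS-vv G j k j<M k<M v = Violations.transposed G (Violations.RHS<LHS-hh (transpose G) j k j<M k<M v)

-- The vertex of the theorem as a grid

sum-map-*ˡ : ∀ {A : Set} (f : A → ℕ) x (xs : List A) → sum (map (λ a → x * f a) xs) ≡ x * sum (map f xs)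
sum-map-*ˡ f x []       = sym (*-zeroʳ x)
sum-map-*ˡ f x (a ∷ xs) = trans (cong (x * f a +_) (sum-map-*ˡ f x xs)) (sym (*-distribˡ-+ x (f a) _))

sum-map-*ʳ : ∀ {A : Set} (f : A → ℕ) x (xs : List A) → sum (map (λ a → f a * x) xs) ≡ sum (map f xs) * x
sum-map-*ʳ f x []       = refl
sum-map-*ʳ f x (a ∷ xs) = trans (cong (f a * x +_) (sum-map-*ʳ f x xs)) (sym (*-distribʳ-+ x (f a) _))

map-allFin : ∀ {A : Set} n (f : Fin n → A) (h : ℕ → A) → (∀ i → f i ≡ h (toℕ i)) → map f (allFin n) ≡ applyUpTo h n
map-allFin n f h f≗h = trans (map-tabulate id f) (tabulate≡ n f h f≗h)
  where
    tabulate≡ : ∀ {A : Set} n (f : Fin n → A) (h : ℕ → A) → (∀ i → f i ≡ h (toℕ i)) → tabulate f ≡ applyUpTo h n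
    tabulate≡ zero    f h f≗h = refl
    tabulate≡ (suc n) f h f≗h = cong₂ _∷_ (f≗h fzero) (tabulate≡ n (f ∘ fsuc) (h ∘ suc) (f≗h ∘ fsuc))

module _ {m n : ℕ} where

  hAt-in : ∀ k (k<n : k < pred n) → hAt {m} {n} k ≡ just (hc (fromℕ< k<n))
  hAt-in k k<n with k <? pred n
  ... | yes _   = refl
  ... | no  k≮n = ⊥-elim (k≮n k<n)

  hAt-out : ∀ k → ¬ k < pred n → hAt {m} {n} k ≡ nothing
  hAt-out k k≮n with k <? pred n
  ... | yes k<n = ⊥-elim (k≮n k<n)
  ... | no  _   = refl

  vAt-in : ∀ k (k<m : k < pred m) → vAt {m} {n} k ≡ just (vc (fromℕ< k<m))
  vAt-in k k<m with k <? pred m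
  ... | yes _   = refl
  ... | no  k≮m = ⊥-elim (k≮m k<m)

  vAt-out : ∀ k → ¬ k < pred m → vAt {m} {n} k ≡ nothing
  vAt-out k k≮m with k <? pred m
  ... | yes k<m = ⊥-elim (k≮m k<m)
  ... | no  _   = refl

  hAt-toℕ : ∀ i → hAt {m} {n} (toℕ i) ≡ just (hc i)
  hAt-toℕ i = trans (hAt-in (toℕ i) (toℕ<n i)) (cong (just ∘ hc) (fromℕ<-toℕ i (toℕ<n i)))

  vAt-toℕ : ∀ j → vAt {m} {n} (toℕ j) ≡ just (vc j)
  vAt-toℕ j = trans (vAt-in (toℕ j) (toℕ<n j)) (cong (just ∘ vc) (fromℕ<-toℕ j (toℕ<n j)))

  ltAt-just : ∀ (R : BRel m n) a y {b} → b ≡ just y → ltAt R a y ≡ liftRel (ltB R) a b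
  ltAt-just R (just x) y refl = refl
  ltAt-just R nothing  y refl = refl

module Vertex {m n : ℕ} (v : BRel m n) (vx : IsVertex v) where

  ≤ᵥ-trans : ∀ x y z → x ≤[ v ] y → y ≤[ v ] z → x ≤[ v ] z
  ≤ᵥ-trans = proj₂ (proj₁ (proj₁ vx))

  <ᵥ⇒≤ᵥ∧≱ᵥ : ∀ {x y} → x <[ v ] y → x ≤[ v ] y × v y x ≡ false
  <ᵥ⇒≤ᵥ∧≱ᵥ {x} {y} e with v x y | v y x
  ... | true | false = refl , refl

  ≤ᵥ∧≢⇒<ᵥ : ∀ {x y} → x ≤[ v ] y → x ≢ y → x <[ v ] y
  ≤ᵥ∧≢⇒<ᵥ {x} {y} x≤y x≢y with v y x in y≤x
  ... | true  = ⊥-elim (x≢y (proj₂ vx x y x≤y y≤x))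
  ... | false rewrite x≤y = refl

  <ᵥ-trans : ∀ x y z → x <[ v ] y → y <[ v ] z → x <[ v ] z
  <ᵥ-trans x y z x<y y<z with <ᵥ⇒≤ᵥ∧≱ᵥ x<y | <ᵥ⇒≤ᵥ∧≱ᵥ y<z
  ... | x≤y , y≰x | y≤z , _ with v z x in z≤x
  ...   | true  = ⊥-elim (true≢false (trans (sym (≤ᵥ-trans y z x y≤z z≤x)) y≰x))
  ...   | false rewrite ≤ᵥ-trans x y z x≤y y≤z = refl

  <ᵥ-irrefl : ∀ x → ltB v x x ≡ false
  <ᵥ-irrefl x with v x x
  ... | true  = refl
  ... | false = refl

  liftRel-just : ∀ {a b x y} → a ≡ just x → b ≡ just y → x <[ v ] y → liftRel (ltB v) a b ≡ true
  liftRel-just refl refl x<y = x<y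

  incomparable : ∀ {x y} → x ≢ y → ltB v x y ≡ false → ltB v y x ≡ false → ¬ Comparable v x y
  incomparable x≢y x≮y _   (inj₁ x≤y) = true≢false (trans (sym (≤ᵥ∧≢⇒<ᵥ x≤y x≢y)) x≮y)
  incomparable x≢y _   y≮x (inj₂ y≤x) = true≢false (trans (sym (≤ᵥ∧≢⇒<ᵥ y≤x (≢-sym x≢y))) y≮x)

-- One direction of collisions (own, indexed through `at`), with the orthogonal ones (other)
-- as potential links; the clause of IsGoodRect for this direction becomes hGap/hLink of a Grid.
module Direction {m n K K′ : ℕ} (v : BRel m n) (vx : IsVertex v)
    (own : Fin K → Coll m n) (other : Fin K′ → Coll m n)
    (own-injective : ∀ {a b} → own a ≡ own b → a ≡ b) (own≢other : ∀ a s → own a ≢ other s)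
    (at : ℕ → Maybe (Coll m n)) (at-in : ∀ k (k<K : k < K) → at k ≡ just (own (fromℕ< k<K)))
    (at-out : ∀ k → ¬ k < K → at k ≡ nothing)
    (at-toℕ : ∀ s → at (toℕ s) ≡ just (own s))
    (otherAt : ℕ → Maybe (Coll m n)) (otherAt-toℕ : ∀ s → otherAt (toℕ s) ≡ just (other s)) where

  open Vertex v vx

  OrthLink : Fin K → Fin K → Set
  OrthLink j j′ = Σ (Fin K′) λ s → (own j ≤[ v ] other s × other s ≤[ v ] own j′) ⊎ (own j′ ≤[ v ] other s × other s ≤[ v ] own j)

  OwnGap : Fin K → Fin K → Set
  OwnGap j j′ = Σ (Fin K) λ s → Between {m} {n} j j′ s × own j <[ v ] own s × own j′ <[ v ] own s

  module _ (par : ∀ j j′ → (Comparable v (own j) (own j′) → OrthLink j j′ ⊎ ¬ OwnGap j j′)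
                         × (OrthLink j j′ ⊎ ¬ OwnGap j j′ → Comparable v (own j) (own j′))) where

    private
      fromOwnGap : ∀ {i k} (i<K : i < K) (k<K : k < K) → OwnGap (fromℕ< i<K) (fromℕ< k<K) → Gap (ltB v) at i k
      fromOwnGap {i} {k} i<K k<K (s , btw , i<s , k<s) =
        toℕ s , within btw , lift (at-in i i<K) i<s , lift (at-in k k<K) k<s
        where
          lift : ∀ {j x} → at j ≡ just x → x <[ v ] own s → liftRel (ltB v) (at j) (at (toℕ s)) ≡ true
          lift e x<s rewrite e | at-toℕ s = x<s
          within : Between {m} {n} (fromℕ< i<K) (fromℕ< k<K) s → Within i k (toℕ s)
          within btw rewrite toℕ-fromℕ< i<K | toℕ-fromℕ< k<K = btw

      toOwnGap : ∀ {i k} (i<K : i < K) (k<K : k < K) → Gap (ltB v) at i k → OwnGap (fromℕ< i<K) (fromℕ< k<K)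
      toOwnGap {i} {k} i<K k<K (s , w , i<s , k<s) with s <? K
      ... | no  s≮K rewrite at-out s s≮K | at-in i i<K = ⊥-elim (true≢false (sym i<s))
      ... | yes s<K rewrite at-in s s<K | at-in i i<K | at-in k k<K = fromℕ< s<K , between w , i<s , k<s
        where
          between : Within i k s → Between {m} {n} (fromℕ< i<K) (fromℕ< k<K) (fromℕ< s<K)
          between w rewrite toℕ-fromℕ< i<K | toℕ-fromℕ< k<K | toℕ-fromℕ< s<K = w

    gap : ∀ i k → i < K → k < K → i ≢ k →
          liftRel (ltB v) (at i) (at k) ≡ false → liftRel (ltB v) (at k) (at i) ≡ false → ¬ ¬ Gap (ltB v) at i k
    gap i k i<K k<K i≢k i≮k k≮i noGap =
      incomparable own≢ (subst₂ (λ a b → liftRel (ltB v) a b ≡ false) (at-in i i<K) (at-in k k<K) i≮k)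
                        (subst₂ (λ a b → liftRel (ltB v) a b ≡ false) (at-in k k<K) (at-in i i<K) k≮i)
        (proj₂ (par (fromℕ< i<K) (fromℕ< k<K)) (inj₂ (noGap ∘ fromOwnGap i<K k<K)))
      where
        own≢ : own (fromℕ< i<K) ≢ own (fromℕ< k<K)
        own≢ e = i≢k (trans (sym (toℕ-fromℕ< i<K)) (trans (cong toℕ (own-injective e)) (toℕ-fromℕ< k<K)))

    link : ∀ i k → i < K → k < K → liftRel (ltB v) (at i) (at k) ≡ true →
           (Σ ℕ λ s → s < K′ × liftRel (ltB v) (at i) (otherAt s) ≡ true × liftRel (ltB v) (otherAt s) (at k) ≡ true)
           ⊎ ¬ Gap (ltB v) at i k
    link i k i<K k<K i<k with proj₁ (par (fromℕ< i<K) (fromℕ< k<K)) (inj₁ (proj₁ (<ᵥ⇒≤ᵥ∧≱ᵥ x<y)))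
      where x<y = subst₂ (λ a b → liftRel (ltB v) a b ≡ true) (at-in i i<K) (at-in k k<K) i<k
    ... | inj₂ noGap = inj₂ (noGap ∘ toOwnGap i<K k<K)
    ... | inj₁ (s , inj₂ (k≤s , s≤i)) = ⊥-elim (true≢false (trans (sym (≤ᵥ-trans _ _ _ k≤s s≤i)) y≰x))
      where y≰x = proj₂ (<ᵥ⇒≤ᵥ∧≱ᵥ (subst₂ (λ a b → liftRel (ltB v) a b ≡ true) (at-in i i<K) (at-in k k<K) i<k))
    ... | inj₁ (s , inj₁ (i≤s , s≤k)) =
      inj₁ (toℕ s , toℕ<n s , liftRel-just (at-in i i<K) (otherAt-toℕ s) (≤ᵥ∧≢⇒<ᵥ i≤s (own≢other _ s))
                           , liftRel-just (otherAt-toℕ s) (at-in k k<K) (≤ᵥ∧≢⇒<ᵥ s≤k (≢-sym (own≢other _ s))))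

module VertexGrid (m′ n′ : ℕ) (v : BRel (suc m′) (suc n′)) (vx : IsVertex v) (c : Coll (suc m′) (suc n′) → Bool) where
  open Vertex v vx

  private
    good = proj₁ vx

    hc-injective : ∀ {a b} → hc {suc m′} {suc n′} a ≡ hc b → a ≡ b
    hc-injective refl = refl

    vc-injective : ∀ {a b} → vc {suc m′} {suc n′} a ≡ vc b → a ≡ b
    vc-injective refl = refl

    module H = Direction v vx hc vc hc-injective (λ _ _ ()) hAt hAt-in hAt-out hAt-toℕ vAt vAt-toℕ
    module V = Direction v vx vc hc vc-injective (λ _ _ ()) vAt vAt-in vAt-out vAt-toℕ hAt hAt-toℕ

    orth′ : ∀ i j → i < n′ → j < m′ →
            liftRel (ltB v) (hAt i) (vAt j) ≡ true ⊎ liftRel (ltB v) (vAt j) (hAt i) ≡ true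
    orth′ i j i<n j<m with proj₁ (proj₂ good) (fromℕ< j<m) (fromℕ< i<n)
    ... | inj₁ vc≤hc = inj₂ (liftRel-just (vAt-in j j<m) (hAt-in i i<n) (≤ᵥ∧≢⇒<ᵥ vc≤hc (λ ())))
    ... | inj₂ hc≤vc = inj₁ (liftRel-just (hAt-in i i<n) (vAt-in j j<m) (≤ᵥ∧≢⇒<ᵥ hc≤vc (λ ())))

  grid : Grid
  grid = record
    { Carrier = Coll (suc m′) (suc n′) ; _≺_ = ltB v ; inC₁ = c ; N = n′ ; M = m′ ; hor = hAt ; ver = vAt
    ; ≺-trans = <ᵥ-trans ; ≺-irrefl = <ᵥ-irrefl ; orth = orth′
    ; hGap = H.gap (proj₂ (proj₂ (proj₂ good))) ; vGap = V.gap (proj₁ (proj₂ (proj₂ good)))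
    ; hLink = H.link (proj₂ (proj₂ (proj₂ good))) ; vLink = V.link (proj₁ (proj₂ (proj₂ good))) }

  private
    module I = Intervals grid
    module J = Intervals (transpose grid)

    yCoord≡coord : ∀ i → yCoord v i ≡ I.coord (toℕ i)
    yCoord≡coord i = cong₂ _*_
      (cong₂ _*_ (cong suc (leftRun-cong f≗ (toℕ i))) (cong suc (rightRun-cong f≗ (suc (toℕ i)) (n′ ∸ suc (toℕ i)))))
      (cong suc (pairCount-cong g≗ (suc m′)))
      where
        f≗ : ∀ k → ltAt v (hAt k) (hc i) ≡ liftRel (ltB v) (hAt k) (hAt (toℕ i))
        f≗ k = ltAt-just v (hAt k) (hc i) (hAt-toℕ i)
        g≗ : ∀ k → ltAt v (vAt k) (hc i) ≡ liftRel (ltB v) (vAt k) (hAt (toℕ i))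
        g≗ k = ltAt-just v (vAt k) (hc i) (hAt-toℕ i)

    xCoord≡coord : ∀ j → xCoord v j ≡ J.coord (toℕ j)
    xCoord≡coord j = cong₂ _*_
      (cong₂ _*_ (cong suc (leftRun-cong f≗ (toℕ j))) (cong suc (rightRun-cong f≗ (suc (toℕ j)) (m′ ∸ suc (toℕ j)))))
      (cong suc (pairCount-cong g≗ (suc n′)))
      where
        f≗ : ∀ k → ltAt v (vAt k) (vc j) ≡ liftRel (ltB v) (vAt k) (vAt (toℕ j))
        f≗ k = ltAt-just v (vAt k) (vc j) (vAt-toℕ j)
        g≗ : ∀ k → ltAt v (hAt k) (vc j) ≡ liftRel (ltB v) (hAt k) (vAt (toℕ j))
        g≗ k = ltAt-just v (hAt k) (vc j) (vAt-toℕ j)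

    hBlocks-sum : sum (map triangular (hBlocks {suc m′} {suc n′} c)) ≡ intervalCount I.hIn n′
    hBlocks-sum = trans (cong (sum ∘ map triangular ∘ runs) (map-allFin n′ _ I.hIn (λ i → cong (liftPred c) (sym (hAt-toℕ i)))))
                        (sum-triangular-runs I.hIn n′)

    vBlocks-sum : sum (map triangular (vBlocks {suc m′} {suc n′} c)) ≡ intervalCount J.hIn m′
    vBlocks-sum = trans (cong (sum ∘ map triangular ∘ runs) (map-allFin m′ _ J.hIn (λ j → cong (liftPred c) (sym (vAt-toℕ j)))))
                        (sum-triangular-runs J.hIn m′)

  lhsSum≡LHS : lhsSum c v ≡ Totals.LHS grid
  lhsSum≡LHS = cong₂ _+_
    (cong sum (map-allFin n′ _ (λ k → 𝟙 (I.hIn k) * I.coord k) (λ i →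
      trans (if-* (c (hc i)) _) (cong₂ (λ b y → 𝟙 b * y) (cong (liftPred c) (sym (hAt-toℕ i))) (yCoord≡coord i)))))
    (cong sum (map-allFin m′ _ (λ k → 𝟙 (J.hIn k) * J.coord k) (λ j →
      trans (if-* (c (vc j)) _) (cong₂ (λ b y → 𝟙 b * y) (cong (liftPred c) (sym (vAt-toℕ j))) (xCoord≡coord j)))))

  rhsSum≡RHS : rhsSum c ≡ Totals.RHS grid
  rhsSum≡RHS = cong₂ _+_ (cong₂ _+_ hBlocks-sum vBlocks-sum)
    (trans (cong sum (map-cong (λ a → sum-map-*ˡ triangular (triangular a) bs) as))
      (trans (sum-map-*ʳ triangular (sum (map triangular bs)) as) (cong₂ _*_ hBlocks-sum vBlocks-sum)))
    where
      as = hBlocks {suc m′} {suc n′} c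
      bs = vBlocks {suc m′} {suc n′} c

  module _ (F : BRel (suc m′) (suc n′)) (twoClasses : TwoClasses F c) where

    private
      F⇒classes : ∀ x y → x ≤[ F ] y → c x ≡ true ⊎ c y ≡ false
      F⇒classes x y = proj₁ (proj₁ twoClasses x y)

      classes⇒F : ∀ x y → c x ≡ true ⊎ c y ≡ false → x ≤[ F ] y
      classes⇒F x y = proj₂ (proj₁ twoClasses x y)

      atViolation : ∀ {a b x y} → a ≡ just x → b ≡ just y → x <[ v ] y → c x ≡ false → c y ≡ true → I.Violation a b
      atViolation refl refl x<y x∉ y∈ = x<y , x∉ , y∈

      violation : ∀ x y → x <[ v ] y → c x ≡ false → c y ≡ true → Totals.RHS grid < Totals.LHS grid
      violation (hc i) (hc k) x<y x∉ y∈ = Violations.RHS<LHS-hh grid (toℕ i) (toℕ k) (toℕ<n i) (toℕ<n k)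
        (atViolation (hAt-toℕ i) (hAt-toℕ k) x<y x∉ y∈)
      violation (hc i) (vc j) x<y x∉ y∈ = Totals.RHS<LHS-hv grid (toℕ i) (toℕ j) (toℕ<n i) (toℕ<n j)
        (atViolation (hAt-toℕ i) (vAt-toℕ j) x<y x∉ y∈)
      violation (vc j) (hc i) x<y x∉ y∈ = Violations.RHS<LHS-vh grid (toℕ j) (toℕ i) (toℕ<n j) (toℕ<n i)
        (atViolation (vAt-toℕ j) (hAt-toℕ i) x<y x∉ y∈)
      violation (vc j) (vc k) x<y x∉ y∈ = RHS<LHS-vv grid (toℕ j) (toℕ k) (toℕ<n j) (toℕ<n k)
        (atViolation (vAt-toℕ j) (vAt-toℕ k) x<y x∉ y∈)

      -- x ≤ y in v but not in F forces x ∈ C₂ and y ∈ C₁, hence x ≠ y and x < y in v.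
      violation-⋢ : ∀ x y → x ≤[ v ] y → F x y ≡ false → Totals.RHS grid < Totals.LHS grid
      violation-⋢ x y x≤y x≰y = violation x y (≤ᵥ∧≢⇒<ᵥ x≤y x≢y) x∉ y∈
        where
          x∉ : c x ≡ false
          x∉ with c x in eq
          ... | false = refl
          ... | true  = ⊥-elim (true≢false (trans (sym (classes⇒F x y (inj₁ eq))) x≰y))
          y∈ : c y ≡ true
          y∈ with c y in eq
          ... | true  = refl
          ... | false = ⊥-elim (true≢false (trans (sym (classes⇒F x y (inj₂ eq))) x≰y))
          x≢y : x ≢ y
          x≢y refl = true≢false (trans (sym y∈) x∉)

    lhsSum≡rhsSum : v ⊑ F → lhsSum c v ≡ rhsSum c
    lhsSum≡rhsSum v⊑F = trans lhsSum≡LHS (trans (Totals.LHS≡RHS grid downClosed) (sym rhsSum≡RHS))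
      where
        downClosed : I.DownClosed
        downClosed x y x<y y∈ with F⇒classes x y (v⊑F x y (proj₁ (<ᵥ⇒≤ᵥ∧≱ᵥ x<y)))
        ... | inj₁ x∈ = x∈
        ... | inj₂ y∉ = ⊥-elim (true≢false (trans (sym y∈) y∉))

    rhsSum<lhsSum : ¬ (v ⊑ F) → rhsSum c < lhsSum c v
    rhsSum<lhsSum v⋢F with rhsSum c <? lhsSum c v
    ... | yes lt = lt
    ... | no  ≮  = ⊥-elim (v⋢F v⊑F)
      where
        v⊑F : v ⊑ F
        v⊑F x y x≤y with F x y in Fxy
        ... | true  = refl
        ... | false = ⊥-elim (≮ (subst₂ _<_ (sym rhsSum≡RHS) (sym lhsSum≡LHS) (violation-⋢ x y x≤y Fxy)))

mainTheorem16 : (m n : ℕ) → 1 ≤ m → 1 ≤ n →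
    (F : BRel m n) → IsGoodRect F →
    (c : Coll m n → Bool) → TwoClasses F c →
    Σ (Fin _) (λ i → c (hc i) ≡ true) → Σ (Fin _) (λ j → c (vc j) ≡ true) →
    ((v : BRel m n) → IsVertex v → v ⊑ F → lhsSum c v ≡ rhsSum c)
    × ((v : BRel m n) → IsVertex v → ¬ (v ⊑ F) → ¬ (F ⊑ v) → rhsSum c < lhsSum c v)
mainTheorem16 (suc m′) (suc n′) _ _ F _ c twoClasses _ _ =
  (λ v vx → VertexGrid.lhsSum≡rhsSum m′ n′ v vx c F twoClasses) ,
  (λ v vx v⋢F _ → VertexGrid.rhsSum<lhsSum m′ n′ v vx c F twoClasses v⋢F)
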